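{- Let $M\ge 1$, $N\ge 0$, $r\ge1$ be integers, $x,y$ indeterminates, and let $0\le a_1<\dots<a_r<M$ and $0\le e_1<\dots<e_r<M$ be integers with $N-e_i+a_j\equiv 0\pmod 2$ for all $1\le i,j\le r$. Then $$\sum_{\pi\in\mathcal S_r}\ \sum_{(P_1,\dots,P_r)}\operatorname{sgn}(\pi)\prod_{k=1}^r w_y(P_k)=\det\bigl(q(M,N,a_i,e_j;x,y)\bigr)_{i,j=1}^r,$$ where the inner sum runs over all $r$-tuples of non-intersecting lattice paths in the $M$-cylinder with $P_k$ starting at $(a_k,0)$ and ending at $(e_{\pi(k)},N)$.
   Context: Lattice paths in $\mathbb Z\times\mathbb Z$ with $N$ steps: sequences $(u_0,0),(u_1,1),\dots,(u_N,N)$ with $u_t-u_{t-1}\in\{\pm1\}$; a $-1$ step has weight $x$, a $+1$ step weight $1$. The $M$-cylinder is the image of $\mathbb Z\times\mathbb Z$ under $\mathcal W:(u,t)\mapsto(u\bmod M,t)$ (residues represented by $0,\dots,M-1$); lattice paths in the $M$-cylinder are images under $\mathcal W$ of lattice paths in the plane. For a cylinder path $p$ from $(a,0)$ to $(e,N)$ with $0\le a,e<M$, its unique lift starting at $(a,0)$ ends at $(e+oM,N)$ for a unique integer $o$, the offset of $p$. Its weight is $w_y(p)=y^{o}\,x^{L}$, where $L$ is the number of $-1$ steps. Paths are non-intersecting if no two share a vertex of the cylinder. For integers $a,e$, $$q(M,N,a,e;x,y)=\sum_{o\in\mathbb Z,\ N-e-oM+a\equiv0\ (2)}\binom{N}{\frac{N-e-oM+a}{2}}y^{o}x^{\frac{N-e-oM+a}{2}}.$$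 -}

module Defs where

open import Level using (Level)
open import Data.Bool using (Bool; true; false; if_then_else_)
open import Data.Nat as ℕ using (ℕ; zero; suc; NonZero)
open import Data.Nat.Combinatorics using (_C_)
open import Data.Nat.DivMod as NDM using ()
open import Data.Integer as ℤ using (ℤ; +_; -[1+_])
open import Data.Integer.DivMod using (_/ℕ_; _%ℕ_)
open import Data.Fin as Fin using (Fin; zero; suc)
open import Data.Fin.Properties using (all?)
open import Data.Vec as Vec using (Vec; []; _∷_)
open import Data.List as List using (List; []; _∷_; concatMap; map; filter; upTo; allFin; length; foldr)
open import Data.Product using (_×_)
open import Relation.Nullary using (¬_; Dec; does)
open import Relation.Nullary.Decidable using (_×-dec_; _→-dec_; ¬?)
open import Relation.Binary.PropositionalEquality using (_≡_)
open import Algebra.Bundles using (CommutativeRing)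

allVec : ∀ {a} {A : Set a} (n : ℕ) → List A → List (Vec A n)
allVec zero    xs = [] ∷ []
allVec (suc n) xs = concatMap (λ u → map (u ∷_) (allVec n xs)) xs

allFun : ∀ {a} {A : Set a} (n : ℕ) → List A → List (Fin n → A)
allFun zero    xs = (λ ()) ∷ []
allFun (suc n) xs =
  concatMap (λ u → map (λ f → λ { zero → u ; (suc i) → f i }) (allFun n xs)) xs

IsPerm : ∀ {r} → (Fin r → Fin r) → Set
IsPerm {r} π = ∀ (i j : Fin r) → π i ≡ π j → i ≡ j

isPerm? : ∀ {r} (π : Fin r → Fin r) → Dec (IsPerm π)
isPerm? π = all? (λ i → all? (λ j → (π i Fin.≟ π j) →-dec (i Fin.≟ j)))

perms : (r : ℕ) → List (Fin r → Fin r)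
perms r = filter isPerm? (allFun r (allFin r))

inversions : ∀ {r} → (Fin r → Fin r) → ℕ
inversions {r} π =
  length (filter (λ ij → Fin._<?_ (Data.Product.proj₁ ij) (Data.Product.proj₂ ij)
                          ×-dec Fin._<?_ (π (Data.Product.proj₂ ij)) (π (Data.Product.proj₁ ij)))
                 (List.cartesianProduct (allFin r) (allFin r)))
  where import Data.Product

-- Lattice paths with N steps, given by their step sequence
-- (true = +1 step, weight 1; false = -1 step, weight x).

Path : ℕ → Set
Path N = Vec Bool N

allPaths : (N : ℕ) → List (Path N)
allPaths N = allVec N (true ∷ false ∷ [])

step : Bool → ℤ → ℤ
step true  u = u ℤ.+ ℤ.+ 1
step false u = u ℤ.- ℤ.+ 1

-- the lift in Z × Z starting at (u,0): the heights u_0,…,u_N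
trace : ∀ {n} → ℤ → Path n → Vec ℤ (suc n)
trace u []       = u ∷ []
trace u (b ∷ bs) = u ∷ trace (step b u) bs

downs : ∀ {n} → Path n → ℕ
downs []           = 0
downs (true ∷ bs)  = downs bs
downs (false ∷ bs) = suc (downs bs)

module Cylinder (M : ℕ) .{{_ : NonZero M}} where

  -- the cylinder vertex W(u,t) at time t has first coordinate u mod M
  res : ℤ → ℕ
  res u = u %ℕ M

  endRes : ∀ {N} → ℕ → Path N → ℕ
  endRes a p = res (Vec.last (trace (+ a) p))

  -- offset o: the lift from (a,0) ends at (e + o M, N), 0 ≤ e < M
  offset : ∀ {N} → ℕ → Path N → ℤ
  offset a p = Vec.last (trace (+ a) p) /ℕ M

  Disjoint : ∀ {N} → ℕ → Path N → ℕ → Path N → Set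
  Disjoint {N} a p b q =
    ∀ (t : Fin (suc N)) → ¬ (res (Vec.lookup (trace (+ a) p) t) ≡ res (Vec.lookup (trace (+ b) q) t))

  disjoint? : ∀ {N} a p b q → Dec (Disjoint {N} a p b q)
  disjoint? a p b q = all? (λ t → ¬? (_ ℕ.≟ _))

  NonIntersecting : ∀ {N r} → (Fin r → ℕ) → (Fin r → Path N) → Set
  NonIntersecting {N} {r} a P = ∀ (k l : Fin r) → ¬ (k ≡ l) → Disjoint (a k) (P k) (a l) (P l)

  nonIntersecting? : ∀ {N r} a P → Dec (NonIntersecting {N} {r} a P)
  nonIntersecting? a P =
    all? (λ k → all? (λ l → ¬? (k Fin.≟ l) →-dec disjoint? (a k) (P k) (a l) (P l)))

  EndsAt : ∀ {N r} → (Fin r → ℕ) → (Fin r → ℕ) → (Fin r → Fin r) → (Fin r → Path N) → Set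
  EndsAt {r = r} a e π P = ∀ (k : Fin r) → endRes (a k) (P k) ≡ e (π k)

  endsAt? : ∀ {N r} a e π P → Dec (EndsAt {N} {r} a e π P)
  endsAt? a e π P = all? (λ k → endRes (a k) (P k) ℕ.≟ e (π k))

  admissible? : ∀ {N r} a e π P → Dec (EndsAt {N} {r} a e π P × NonIntersecting a P)
  admissible? a e π P = endsAt? a e π P ×-dec nonIntersecting? a P

  tuples : (N r : ℕ) → (a e : Fin r → ℕ) → (Fin r → Fin r) → List (Fin r → Path N)
  tuples N r a e π = filter (admissible? a e π) (allFun r (allPaths N))

-- Ring-valued quantities.  x, y are elements of a commutative ring and
-- yinv is an inverse of y (hypothesis in the theorem), so that y^o makes
-- sense for o ∈ ℤ.

module RingDefs {c ℓ : Level} (R : CommutativeRing c ℓ) (x y yinv : CommutativeRing.Carrier R) where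
  open CommutativeRing R using (Carrier; _+_; _*_; -_; 0#; 1#)

  sumL : List Carrier → Carrier
  sumL = foldr _+_ 0#

  prodFin : (n : ℕ) → (Fin n → Carrier) → Carrier
  prodFin zero    f = 1#
  prodFin (suc n) f = f zero * prodFin n (λ i → f (suc i))

  pow : Carrier → ℕ → Carrier
  pow z zero    = 1#
  pow z (suc n) = z * pow z n

  ypow : ℤ → Carrier
  ypow (+ n)     = pow y n
  ypow -[1+ n ]  = pow yinv (suc n)

  natR : ℕ → Carrier
  natR zero    = 0#
  natR (suc n) = 1# + natR n

  sgn : ∀ {r} → (Fin r → Fin r) → Carrier
  sgn π = pow (- 1#) (inversions π)

  det : (r : ℕ) → (Fin r → Fin r → Carrier) → Carrier
  det r A = sumL (map (λ π → sgn π * prodFin r (λ i → A i (π i))) (perms r))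

  -- the term of q for a given offset o; the binomial coefficient
  -- binom(N, s/2) is read as 0 unless s is even and 0 ≤ s/2 ≤ N
  -- (stdlib's N C k is 0 for k > N).
  qTerm : (M N : ℕ) (a e o : ℤ) → Carrier
  qTerm M N a e o with (+ N) ℤ.- e ℤ.- o ℤ.* (+ M) ℤ.+ a
  ... | + s      = if does (s NDM.% 2 ℕ.≟ 0)
                     then natR (N C (s NDM./ 2)) * ypow o * pow x (s NDM./ 2)
                     else 0#
  ... | -[1+ _ ] = 0#

  -- q(M,N,a,e;x,y): the sum over o ∈ ℤ; for M ≥ 1 only offsets with
  -- |o| ≤ B = N + |a| + |e| can contribute, so we sum over o ∈ [-B, B].
  q : (M N : ℕ) (a e : ℤ) → Carrier
  q M N a e = sumL (map (λ i → qTerm M N a e (+ i ℤ.- + B)) (upTo (suc (2 ℕ.* B))))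
    where B = N ℕ.+ ℤ.∣ a ∣ ℕ.+ ℤ.∣ e ∣

  weight : (M : ℕ) .{{_ : NonZero M}} → ∀ {N} → ℕ → Path N → Carrier
  weight M a p = ypow (Cylinder.offset M a p) * pow x (downs p)

  lhs : (M N r : ℕ) .{{_ : NonZero M}} → (a e : Fin r → ℕ) → Carrier
  lhs M N r a e =
    sumL (map (λ π → sumL (map (λ P → sgn π * prodFin r (λ k → weight M (a k) (P k)))
                               (Cylinder.tuples M N r a e π)))
              (perms r))

module Submission where

-- Lindström–Gessel–Viennot on the cylinder.  For e < M, q(M,N,a,e) is the
-- generating function of all cylinder paths from (a,0) to (e,N): a path with
-- L down-steps ends at height a + N - 2L, there are binom(N,L) of them, and
-- the offset is the quotient of that height by M.  Expanding det(q) thus gives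
-- the signed weighted sum over all pairs (π , P) of a permutation and a family
-- with P k ending at e (π k).  On an intersecting family, swapping the tails of
-- the first colliding pair (earliest time, then first pair) is an involution
-- that multiplies π by a transposition and preserves the weight: the offsets
-- add up to the same total, because the swap preserves the sum of the two
-- lifted endpoints and only exchanges their residues.  So the intersecting
-- families cancel and the non-intersecting ones remain.

open import Defs
open import Level using (Level)
open import Algebra.Bundles using (CommutativeMonoid; CommutativeRing)
import Algebra.Properties.CommutativeMonoid.Sum
open import Data.Bool using (Bool; true; false; if_then_else_; _∧_; not)
open import Data.Bool.Properties using (if-∧)
open import Data.Nat as ℕ using (ℕ; zero; suc; NonZero; _≤_; s≤s; z≤n)
import Data.Nat.Properties as ℕ
open import Data.Nat.Combinatorics using (_C_; nCk+nC[k+1]≡[n+1]C[k+1]; k>n⇒nCk≡0)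
open import Data.Nat.Induction using (<-wellFounded)
import Data.Integer
open import Data.Integer as ℤ using (ℤ; +_; -[1+_]; _⊖_)
import Data.Integer.Properties as ℤ
open import Data.Integer.DivMod using (_/ℕ_)
open import Data.Integer.Divisibility using (_∣_)
import Data.Fin
open import Data.Fin as Fin using (Fin; zero; suc; toℕ; punchIn; punchOut)
import Data.Fin.Properties as Fin
open import Data.Fin.Permutation.Components using (transpose; transpose-inverse)
open import Data.Vec as Vec using (Vec; []; _∷_)
import Data.Vec.Properties as Vec
open import Data.Vec.Functional using (removeAt)
open import Data.List as List
  using (List; []; _∷_; _++_; map; foldr; filter; length; allFin; applyUpTo; concatMap; find
        ; cartesianProduct; cartesianProductWith)
open import Data.List.Properties using (length-removeAt′; map-∘)
open import Data.List.Relation.Unary.All as All using (All; []; _∷_)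
import Data.List.Relation.Unary.All.Properties as All
open import Data.List.Relation.Unary.AllPairs using ([]; _∷_)
open import Data.List.Relation.Unary.Any as Any using (Any; here; there; _─_)
import Data.List.Relation.Unary.Any.Properties as Any
open import Data.List.Membership.Propositional using (_∈_)
open import Data.List.Membership.Propositional.Properties
  using (∈-filter⁺; ∈-filter⁻; ∈-cartesianProductWith⁺; ∈-cartesianProduct⁺; ∈-allFin)
import Data.List.Membership.Setoid as MemS
import Data.List.Membership.Setoid.Properties as MemSₚ
import Data.List.Relation.Unary.Unique.Setoid as UniqueS
import Data.List.Relation.Unary.Unique.Setoid.Properties as UniqueSₚ
import Data.List.Relation.Unary.Unique.Propositional as UniqueP
import Data.List.Relation.Unary.Unique.Propositional.Properties as UniquePₚ
open import Data.Maybe as Maybe using (Maybe; just; nothing; _<∣>_)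
open import Data.Product as Product using (_×_; _,_; proj₁; proj₂; ∃)
import Data.Product.Properties as Productₚ
open import Data.Product.Relation.Binary.Pointwise.NonDependent using (_×ₛ_)
open import Function using (_∘_)
open import Induction.WellFounded using (Acc; acc)
open import Relation.Binary.Bundles using (Setoid)
open import Relation.Binary.Definitions using (tri<; tri≈; tri>)
open import Relation.Binary.PropositionalEquality as ≡ using (_≡_; _≢_; _→-setoid_)
open import Relation.Nullary using (Dec; yes; no; does; ¬_; contradiction)
open import Relation.Nullary.Decidable using (_×-dec_; ¬?; dec-true; dec-false)
open import Relation.Unary using (Pred; Decidable)

module FoldMap {c ℓ} (CM : CommutativeMonoid c ℓ) where
  open CommutativeMonoid CM
  open import Algebra.Properties.CommutativeSemigroup commutativeSemigroup using (interchange; x∙yz≈y∙xz)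
  open import Relation.Binary.Reasoning.Setoid setoid

  foldMap : ∀ {a} {A : Set a} → (A → Carrier) → List A → Carrier
  foldMap f xs = foldr _∙_ ε (map f xs)

  module _ {a} {A : Set a} where

    foldMap-cong : ∀ {f g : A → Carrier} → (∀ x → f x ≈ g x) → ∀ xs → foldMap f xs ≈ foldMap g xs
    foldMap-cong f≈g []       = refl
    foldMap-cong f≈g (x ∷ xs) = ∙-cong (f≈g x) (foldMap-cong f≈g xs)

    foldMap-++ : ∀ (f : A → Carrier) xs ys → foldMap f (xs ++ ys) ≈ foldMap f xs ∙ foldMap f ys
    foldMap-++ f []       ys = sym (identityˡ _)
    foldMap-++ f (x ∷ xs) ys = trans (∙-congˡ (foldMap-++ f xs ys)) (sym (assoc _ _ _))

    foldMap-∙ : ∀ (f g : A → Carrier) xs → foldMap (λ x → f x ∙ g x) xs ≈ foldMap f xs ∙ foldMap g xs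
    foldMap-∙ f g []       = sym (identityˡ ε)
    foldMap-∙ f g (x ∷ xs) = trans (∙-congˡ (foldMap-∙ f g xs)) (interchange _ _ _ _)

    foldMap-ε : ∀ {f : A → Carrier} {xs} → All (λ x → f x ≈ ε) xs → foldMap f xs ≈ ε
    foldMap-ε []           = refl
    foldMap-ε (fx≈ε ∷ f≈ε) = trans (∙-cong fx≈ε (foldMap-ε f≈ε)) (identityˡ ε)

    foldMap-filter : ∀ {p} {P : Pred A p} (P? : Decidable P) (f : A → Carrier) xs →
                     foldMap f (filter P? xs) ≈ foldMap (λ x → if does (P? x) then f x else ε) xs
    foldMap-filter P? f []       = refl
    foldMap-filter P? f (x ∷ xs) with does (P? x)
    ... | true  = ∙-congˡ (foldMap-filter P? f xs)
    ... | false = trans (foldMap-filter P? f xs) (sym (identityˡ _))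

    foldMap-─ : ∀ {p} {P : Pred A p} (f : A → Carrier) {xs} (w : Any P xs) →
                foldMap f xs ≈ f (Any.lookup w) ∙ foldMap f (xs ─ w)
    foldMap-─ f (here _)           = refl
    foldMap-─ f {x ∷ xs} (there w) = trans (∙-congˡ (foldMap-─ f w)) (x∙yz≈y∙xz _ _ _)

  module _ {a b} {A : Set a} {B : Set b} where

    foldMap-map : ∀ (f : B → Carrier) (g : A → B) xs → foldMap f (map g xs) ≡ foldMap (f ∘ g) xs
    foldMap-map f g xs = ≡.cong (foldr _∙_ ε) (≡.sym (map-∘ xs))

  module _ {a b d} {A : Set a} {B : Set b} {C : Set d} where

    foldMap-cartesianProductWith : ∀ (f : C → Carrier) (g : A → B → C) xs ys →
      foldMap f (cartesianProductWith g xs ys) ≈ foldMap (λ x → foldMap (λ y → f (g x y)) ys) xs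
    foldMap-cartesianProductWith f g []       ys = refl
    foldMap-cartesianProductWith f g (x ∷ xs) ys = begin
      foldMap f (map (g x) ys ++ cartesianProductWith g xs ys)
        ≈⟨ foldMap-++ f (map (g x) ys) _ ⟩
      foldMap f (map (g x) ys) ∙ foldMap f (cartesianProductWith g xs ys)
        ≈⟨ ∙-cong (reflexive (foldMap-map f (g x) ys)) (foldMap-cartesianProductWith f g xs ys) ⟩
      foldMap (λ y → f (g x y)) ys ∙ foldMap (λ x → foldMap (λ y → f (g x y)) ys) xs ∎

  module _ {a b} (S : Setoid a b) where
    open Setoid S using () renaming (Carrier to A; _≈_ to _≃_; refl to ≃-refl; sym to ≃-sym; trans to ≃-trans)
    open MemS S using () renaming (_∈_ to _∈ₛ_; _∉_ to _∉ₛ_)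
    open MemSₚ using (∈-resp-≈; All[≉]⇒∉)
    open UniqueS S using (Unique)

    private
      ∈-─⁻ : ∀ {x xs y} (w : y ∈ₛ xs) → x ∈ₛ (xs ─ w) → x ∈ₛ xs
      ∈-─⁻ (here _)  v         = there v
      ∈-─⁻ (there w) (here x≃) = here x≃
      ∈-─⁻ (there w) (there v) = there (∈-─⁻ w v)

      ∈-─⁺ : ∀ {x xs y} (w : y ∈ₛ xs) → x ∈ₛ xs → ¬ x ≃ Any.lookup w → x ∈ₛ (xs ─ w)
      ∈-─⁺ (here _)  (here x≃) x≄ = contradiction x≃ x≄
      ∈-─⁺ (here _)  (there v) x≄ = v
      ∈-─⁺ (there w) (here x≃) x≄ = here x≃
      ∈-─⁺ (there w) (there v) x≄ = there (∈-─⁺ w v x≄)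

      lookup-∉-─ : ∀ {xs y} (w : y ∈ₛ xs) → Unique xs → Any.lookup w ∉ₛ (xs ─ w)
      lookup-∉-─ (here _)  (z≄ ∷ _)  = All[≉]⇒∉ S z≄
      lookup-∉-─ (there w) (z≄ ∷ u) (here ≃z) = proj₁ (All.lookupAny z≄ w) (≃-sym ≃z)
      lookup-∉-─ (there w) (_ ∷ u)  (there v) = lookup-∉-─ w u v

      unique-─ : ∀ {xs y} (w : y ∈ₛ xs) → Unique xs → Unique (xs ─ w)
      unique-─ (here _)  (_ ∷ u)  = u
      unique-─ (there w) (z≄ ∷ u) = All.─⁺ w z≄ ∷ unique-─ w u

    foldMap-single : ∀ {f : A → Carrier} → (∀ {x y} → x ≃ y → f x ≈ f y) → ∀ {x xs} → Unique xs → x ∈ₛ xs →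
                     (∀ {y} → y ∈ₛ xs → ¬ y ≃ x → f y ≈ ε) → foldMap f xs ≈ f x
    foldMap-single f-cong (z≄ ∷ _) (here x≃z) f≈ε = trans (∙-cong (f-cong (≃-sym x≃z)) rest≈ε) (identityʳ _)
      where
      rest≈ε = foldMap-ε (All.tabulateₛ S λ y∈ →
        f≈ε (there y∈) λ y≃x → All[≉]⇒∉ S z≄ (∈-resp-≈ S (≃-trans y≃x x≃z) y∈))
    foldMap-single f-cong (z≄ ∷ u) (there x∈) f≈ε =
      trans (∙-cong (f≈ε (here ≃-refl) λ z≃x → All[≉]⇒∉ S z≄ (∈-resp-≈ S (≃-sym z≃x) x∈))
                    (foldMap-single f-cong u x∈ (f≈ε ∘ there)))
            (identityˡ _)

    module _ {F G : A → Carrier} (F-cong : ∀ {x y} → x ≃ y → F x ≈ F y) (G-cong : ∀ {x y} → x ≃ y → G x ≈ G y)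
             (ι : A → A) (ι-cong : ∀ {x y} → x ≃ y → ι x ≃ ι y) where

      foldMap-involution : ∀ xs → Unique xs →
        (∀ {x} → x ∈ₛ xs → ι x ∈ₛ xs) →
        (∀ {x} → x ∈ₛ xs → ι (ι x) ≃ x) →
        (∀ {x} → x ∈ₛ xs → ι x ≃ x → G x ≈ F x) →
        (∀ {x} → x ∈ₛ xs → G x ∙ G (ι x) ≈ F x ∙ F (ι x)) →
        foldMap G xs ≈ foldMap F xs
      foldMap-involution xs₀ unique₀ closed₀ involutive fixed paired =
        go xs₀ (<-wellFounded (length xs₀)) unique₀ (λ x∈ → x∈) closed₀
        where
        ι-injective : ∀ {x y} → x ∈ₛ xs₀ → y ∈ₛ xs₀ → ι x ≃ ι y → x ≃ y
        ι-injective x∈ y∈ ιx≃ιy = ≃-trans (≃-sym (involutive x∈)) (≃-trans (ι-cong ιx≃ιy) (involutive y∈))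

        go : ∀ xs → Acc ℕ._<_ (length xs) → Unique xs → (∀ {x} → x ∈ₛ xs → x ∈ₛ xs₀) →
             (∀ {x} → x ∈ₛ xs → ι x ∈ₛ xs) → foldMap G xs ≈ foldMap F xs
        go []       _        _           _   _      = refl
        go (x ∷ xs) (acc rs) (x≄ ∷ uniq) sub closed with closed (here ≃-refl)
        ... | here ιx≃x = ∙-cong (fixed x∈₀ ιx≃x) (go xs (rs ℕ.≤-refl) uniq (sub ∘ there) closed′)
          where
          x∈₀ = sub (here ≃-refl)
          closed′ : ∀ {y} → y ∈ₛ xs → ι y ∈ₛ xs
          closed′ y∈ with closed (there y∈)
          ... | here ιy≃x = contradiction (∈-resp-≈ S (ι-injective (sub (there y∈)) x∈₀ (≃-trans ιy≃x (≃-sym ιx≃x))) y∈)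
                                          (All[≉]⇒∉ S x≄)
          ... | there ιy∈ = ιy∈
        ... | there w = begin
          G x ∙ foldMap G xs             ≈⟨ ∙-congˡ (foldMap-─ G w) ⟩
          G x ∙ (G z ∙ foldMap G xs′)    ≈⟨ assoc _ _ _ ⟨
          (G x ∙ G z) ∙ foldMap G xs′    ≈⟨ ∙-cong pair (go xs′ (rs shorter) (unique-─ w uniq) sub′ closed′) ⟩
          (F x ∙ F z) ∙ foldMap F xs′    ≈⟨ assoc _ _ _ ⟩
          F x ∙ (F z ∙ foldMap F xs′)    ≈⟨ ∙-congˡ (foldMap-─ F w) ⟨
          F x ∙ foldMap F xs             ∎
          where
          z = Any.lookup w
          xs′ = xs ─ w
          x∈₀ = sub (here ≃-refl)
          ιx≃z : ι x ≃ z
          ιx≃z = Any.lookup-result w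
          pair : G x ∙ G z ≈ F x ∙ F z
          pair = trans (∙-congˡ (G-cong (≃-sym ιx≃z))) (trans (paired x∈₀) (∙-congˡ (F-cong ιx≃z)))
          shorter : length xs′ ℕ.< length (x ∷ xs)
          shorter = s≤s (ℕ.≤-trans (ℕ.n≤1+n _) (ℕ.≤-reflexive (≡.sym (length-removeAt′ xs (Any.index w)))))
          sub′ : ∀ {y} → y ∈ₛ xs′ → y ∈ₛ xs₀
          sub′ = sub ∘ there ∘ ∈-─⁻ w
          closed′ : ∀ {y} → y ∈ₛ xs′ → ι y ∈ₛ xs′
          closed′ y∈′ with closed (there (∈-─⁻ w y∈′))
          ... | here ιy≃x = contradiction (∈-resp-≈ S y≃z y∈′) (lookup-∉-─ w uniq)
            where y≃z = ≃-trans (≃-sym (involutive (sub′ y∈′))) (≃-trans (ι-cong ιy≃x) ιx≃z)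
          ... | there ιy∈ = ∈-─⁺ w ιy∈ λ ιy≃z →
                  All[≉]⇒∉ S x≄ (∈-resp-≈ S (ι-injective (sub′ y∈′) x∈₀ (≃-trans ιy≃z (≃-sym ιx≃z))) (∈-─⁻ w y∈′))

    foldMap-reindex : ∀ {f : A → Carrier} → (∀ {x y} → x ≃ y → f x ≈ f y) →
      ∀ (ι : A → A) → (∀ {x y} → x ≃ y → ι x ≃ ι y) →
      ∀ xs → Unique xs → (∀ {x} → x ∈ₛ xs → ι x ∈ₛ xs) → (∀ {x} → x ∈ₛ xs → ι (ι x) ≃ x) →
      foldMap (f ∘ ι) xs ≈ foldMap f xs
    foldMap-reindex f-cong ι ι-cong xs uniq closed involutive =
      foldMap-involution f-cong (f-cong ∘ ι-cong) ι ι-cong xs uniq closed involutive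
        (λ _ ιx≃x → f-cong ιx≃x)
        (λ x∈ → trans (∙-congˡ (f-cong (involutive x∈))) (comm _ _))

module _ {a b d} {A : Set a} {B : Set b} {C : Set d} where

  concatMap-map≡cartesianProductWith : ∀ (f : A → B → C) xs ys →
    concatMap (λ x → map (f x) ys) xs ≡ cartesianProductWith f xs ys
  concatMap-map≡cartesianProductWith f []       ys = ≡.refl
  concatMap-map≡cartesianProductWith f (x ∷ xs) ys =
    ≡.cong (map (f x) ys ++_) (concatMap-map≡cartesianProductWith f xs ys)

module _ {a} {A : Set a} where

  -- In allFun-unique/complete and prodFin-foldMap the `_` passed for the pairing function is
  -- the anonymous cons of allFun's definition, found by unification with allFun (suc n) xs.
  allFun-unique : ∀ n {xs : List A} → UniqueP.Unique xs → UniqueS.Unique (Fin n →-setoid A) (allFun n xs)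
  allFun-unique zero    _             = [] ∷ []
  allFun-unique (suc n) {xs} xs-unique =
    ≡.subst (UniqueS.Unique (Fin (suc n) →-setoid A)) (≡.sym (concatMap-map≡cartesianProductWith _ xs _))
      (UniqueSₚ.cartesianProductWith⁺ (≡.setoid A) (Fin n →-setoid A) (Fin (suc n) →-setoid A) _
        (λ f≗g → f≗g zero , f≗g ∘ suc) xs-unique (allFun-unique n xs-unique))

  allFun-complete : ∀ n {xs : List A} (f : Fin n → A) → (∀ i → f i ∈ xs) → MemS._∈_ (Fin n →-setoid A) f (allFun n xs)
  allFun-complete zero    f _ = here (λ ())
  allFun-complete (suc n) {xs} f f∈ =
    ≡.subst (MemS._∈_ (Fin (suc n) →-setoid A) f) (≡.sym (concatMap-map≡cartesianProductWith _ xs _))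
      (MemSₚ.∈-resp-≈ (Fin (suc n) →-setoid A) (λ { zero → ≡.refl ; (suc i) → ≡.refl })
        (MemSₚ.∈-cartesianProductWith⁺ (≡.setoid A) (Fin n →-setoid A) (Fin (suc n) →-setoid A)
          (λ { ≡.refl f≗g zero → ≡.refl ; ≡.refl f≗g (suc i) → f≗g i }) (f∈ zero) (allFun-complete n (f ∘ suc) (f∈ ∘ suc))))

  allVec-unique : ∀ n {xs : List A} → UniqueP.Unique xs → UniqueP.Unique (allVec n xs)
  allVec-unique zero    _             = [] ∷ []
  allVec-unique (suc n) {xs} xs-unique =
    ≡.subst UniqueP.Unique (≡.sym (concatMap-map≡cartesianProductWith _∷_ xs _))
      (UniquePₚ.cartesianProductWith⁺ _∷_ Vec.∷-injective xs-unique (allVec-unique n xs-unique))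

  allVec-complete : ∀ {xs : List A} → (∀ x → x ∈ xs) → ∀ {n} (v : Vec A n) → v ∈ allVec n xs
  allVec-complete xs-complete []              = here ≡.refl
  allVec-complete {xs} xs-complete (x ∷ v) =
    ≡.subst (x ∷ v ∈_) (≡.sym (concatMap-map≡cartesianProductWith _∷_ xs _))
      (∈-cartesianProductWith⁺ _∷_ (xs-complete x) (allVec-complete xs-complete v))

allPaths-unique : ∀ N → UniqueP.Unique (allPaths N)
allPaths-unique N = allVec-unique N (((λ ()) ∷ []) ∷ [] ∷ [])

allPaths-complete : ∀ {N} (p : Path N) → p ∈ allPaths N
allPaths-complete = allVec-complete λ { true → here ≡.refl ; false → there (here ≡.refl) }

pairs : ∀ r → List (Fin r × Fin r)
pairs r = cartesianProduct (allFin r) (allFin r)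

module _ {r : ℕ} where

  IsPerm-resp : ∀ {σ τ : Fin r → Fin r} → (∀ i → σ i ≡ τ i) → IsPerm σ → IsPerm τ
  IsPerm-resp σ≗τ σ-perm i j τi≡τj = σ-perm i j (≡.trans (σ≗τ i) (≡.trans τi≡τj (≡.sym (σ≗τ j))))

  IsPerm-∘ : ∀ {σ τ : Fin r → Fin r} → IsPerm σ → IsPerm τ → IsPerm (σ ∘ τ)
  IsPerm-∘ σ-perm τ-perm i j στi≡στj = τ-perm i j (σ-perm _ _ στi≡στj)

  involution⇒IsPerm : ∀ {τ : Fin r → Fin r} → (∀ i → τ (τ i) ≡ i) → IsPerm τ
  involution⇒IsPerm {τ} τ-involutive i j τi≡τj =
    ≡.trans (≡.sym (τ-involutive i)) (≡.trans (≡.cong τ τi≡τj) (τ-involutive j))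

  perms-unique : UniqueS.Unique (Fin r →-setoid Fin r) (perms r)
  perms-unique = UniqueSₚ.filter⁺ (Fin r →-setoid Fin r) isPerm? (allFun-unique r (UniquePₚ.allFin⁺ r))

  perms-complete : ∀ {π : Fin r → Fin r} → IsPerm π → MemS._∈_ (Fin r →-setoid Fin r) π (perms r)
  perms-complete {π} π-perm =
    MemSₚ.∈-filter⁺ (Fin r →-setoid Fin r) isPerm? IsPerm-resp (allFun-complete r π (λ i → ∈-allFin (π i))) π-perm

  pairs-unique : UniqueP.Unique (pairs r)
  pairs-unique = UniquePₚ.cartesianProduct⁺ (UniquePₚ.allFin⁺ r) (UniquePₚ.allFin⁺ r)

  ∈-pairs : ∀ (k l : Fin r) → (k , l) ∈ pairs r
  ∈-pairs k l = ∈-cartesianProduct⁺ (∈-allFin k) (∈-allFin l)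

module _ {r : ℕ} where

  transpose-matchˡ : ∀ (k l : Fin r) → transpose k l k ≡ l
  transpose-matchˡ k l rewrite dec-true (k Fin.≟ k) ≡.refl = ≡.refl

  transpose-matchʳ : ∀ (k l : Fin r) → transpose k l l ≡ k
  transpose-matchʳ k l with l Fin.≟ k
  ... | yes l≡k = l≡k
  ... | no  _   rewrite dec-true (l Fin.≟ l) ≡.refl = ≡.refl

  transpose-other : ∀ {k l i : Fin r} → i ≢ k → i ≢ l → transpose k l i ≡ i
  transpose-other {k} {l} {i} i≢k i≢l rewrite dec-false (i Fin.≟ k) i≢k | dec-false (i Fin.≟ l) i≢l = ≡.refl

  transpose-comm : ∀ (k l i : Fin r) → transpose k l i ≡ transpose l k i
  transpose-comm k l i = cases (i Fin.≟ k) (i Fin.≟ l)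
    where
    cases : Dec (i ≡ k) → Dec (i ≡ l) → transpose k l i ≡ transpose l k i
    cases (yes ≡.refl) _            = ≡.trans (transpose-matchˡ i l) (≡.sym (transpose-matchʳ l i))
    cases (no _)       (yes ≡.refl) = ≡.trans (transpose-matchʳ k i) (≡.sym (transpose-matchˡ i k))
    cases (no i≢k)     (no i≢l)     = ≡.trans (transpose-other i≢k i≢l) (≡.sym (transpose-other i≢l i≢k))

  transpose-involutive : ∀ (k l i : Fin r) → transpose k l (transpose k l i) ≡ i
  transpose-involutive k l i = ≡.trans (≡.cong (transpose k l) (transpose-comm k l i)) (transpose-inverse k l)

module Sign {c ℓ : Level} (R : CommutativeRing c ℓ) (x y yinv : CommutativeRing.Carrier R) where
  open CommutativeRing R hiding (zero)
  open Data.Fin using (_<_; _<?_)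
  open RingDefs R x y yinv
  open import Algebra.Properties.Ring ring using (-1*x≈-x; -‿involutive)
  open import Relation.Binary.Reasoning.Setoid setoid
  module Π = FoldMap *-commutativeMonoid

  -1*-1≈1 : - 1# * - 1# ≈ 1#
  -1*-1≈1 = trans (-1*x≈-x (- 1#)) (-‿involutive 1#)

  pow-length-filter : ∀ {a p} {A : Set a} {P : Pred A p} (P? : Decidable P) (z : Carrier) xs →
    pow z (length (filter P? xs)) ≈ Π.foldMap (λ x → if does (P? x) then z else 1#) xs
  pow-length-filter P? z []       = refl
  pow-length-filter P? z (x ∷ xs) with does (P? x)
  ... | true  = *-congˡ (pow-length-filter P? z xs)
  ... | false = trans (pow-length-filter P? z xs) (sym (*-identityˡ _))

  module _ {r : ℕ} where

    ascending? : (p : Fin r × Fin r) → Dec (proj₁ p < proj₂ p)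
    ascending? p = proj₁ p <? proj₂ p

    ascendingPairs : List (Fin r × Fin r)
    ascendingPairs = filter ascending? (pairs r)

    ascendingPairs-unique : UniqueP.Unique ascendingPairs
    ascendingPairs-unique = UniquePₚ.filter⁺ ascending? pairs-unique

    ∈-ascendingPairs : ∀ {i j} → i < j → (i , j) ∈ ascendingPairs
    ∈-ascendingPairs i<j = ∈-filter⁺ ascending? (∈-pairs _ _) i<j

    ∈-ascendingPairs⁻ : ∀ {p} → p ∈ ascendingPairs → proj₁ p < proj₂ p
    ∈-ascendingPairs⁻ p∈ = proj₂ (∈-filter⁻ ascending? {xs = pairs r} p∈)

    reversal : (Fin r → Fin r) → Fin r × Fin r → Carrier
    reversal σ p = if does (σ (proj₂ p) <? σ (proj₁ p)) then - 1# else 1#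

    reversal-diagonal : ∀ σ i → reversal σ (i , i) ≡ 1#
    reversal-diagonal σ i rewrite dec-false (σ i <? σ i) (Fin.<-irrefl ≡.refl) = ≡.refl

    sgn≈∏reversal : ∀ σ → sgn σ ≈ Π.foldMap (reversal σ) ascendingPairs
    sgn≈∏reversal σ = begin
      sgn σ
        ≈⟨ pow-length-filter _ (- 1#) (pairs r) ⟩
      Π.foldMap _ (pairs r)
        ≈⟨ Π.foldMap-cong (λ p → reflexive (if-∧ (does (ascending? p)))) (pairs r) ⟩
      Π.foldMap (λ p → if does (ascending? p) then reversal σ p else 1#) (pairs r)
        ≈⟨ Π.foldMap-filter ascending? (reversal σ) (pairs r) ⟨
      Π.foldMap (reversal σ) ascendingPairs ∎

    reversal-< : ∀ σ i j → σ j < σ i → reversal σ (i , j) ≡ - 1#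
    reversal-< σ i j σj<σi rewrite dec-true (σ j <? σ i) σj<σi = ≡.refl

    reversal-≮ : ∀ σ i j → ¬ σ j < σ i → reversal σ (i , j) ≡ 1#
    reversal-≮ σ i j σj≮σi rewrite dec-false (σ j <? σ i) σj≮σi = ≡.refl

    sgn-cong : ∀ {σ τ} → (∀ i → σ i ≡ τ i) → sgn σ ≈ sgn τ
    sgn-cong {σ} {τ} σ≗τ = begin
      sgn σ                                 ≈⟨ sgn≈∏reversal σ ⟩
      Π.foldMap (reversal σ) ascendingPairs ≈⟨ Π.foldMap-cong (λ p → reflexive (reversal-cong p)) ascendingPairs ⟩
      Π.foldMap (reversal τ) ascendingPairs ≈⟨ sgn≈∏reversal τ ⟨
      sgn τ                                 ∎
      where
      reversal-cong : ∀ p → reversal σ p ≡ reversal τ p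
      reversal-cong (i , j) rewrite σ≗τ i | σ≗τ j = ≡.refl

    sort : Fin r → Fin r → Fin r × Fin r
    sort u v = if does (u <? v) then (u , v) else (v , u)

    sort-< : ∀ {u v} → u < v → sort u v ≡ (u , v)
    sort-< {u} {v} u<v rewrite dec-true (u <? v) u<v = ≡.refl

    sort-> : ∀ {u v} → v < u → sort u v ≡ (v , u)
    sort-> {u} {v} v<u rewrite dec-false (u <? v) (Fin.<-asym v<u) = ≡.refl

    sort-diagonal : ∀ u → sort u u ≡ (u , u)
    sort-diagonal u rewrite dec-false (u <? u) (Fin.<-irrefl ≡.refl) = ≡.refl

    sort-ascending : ∀ {u v} → u ≢ v → proj₁ (sort u v) < proj₂ (sort u v)
    sort-ascending {u} {v} u≢v with Fin.<-cmp u v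
    ... | tri< u<v _ _ rewrite sort-< u<v = u<v
    ... | tri≈ _ u≡v _ = contradiction u≡v u≢v
    ... | tri> _ _ v<u rewrite sort-> v<u = v<u

    module _ (τ : Fin r → Fin r) (τ-involutive : ∀ i → τ (τ i) ≡ i) where

      private
        τ-injective : IsPerm τ
        τ-injective = involution⇒IsPerm τ-involutive

      sortImage : Fin r × Fin r → Fin r × Fin r
      sortImage p = sort (τ (proj₁ p)) (τ (proj₂ p))

      sortImage-ascending : ∀ {p} → p ∈ ascendingPairs → sortImage p ∈ ascendingPairs
      sortImage-ascending {i , j} p∈ =
        ∈-ascendingPairs (sort-ascending (Fin.<⇒≢ (∈-ascendingPairs⁻ p∈) ∘ τ-injective i j))

      sortImage-involutive : ∀ {p} → p ∈ ascendingPairs → sortImage (sortImage p) ≡ p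
      sortImage-involutive {i , j} p∈ with Fin.<-cmp (τ i) (τ j) | ∈-ascendingPairs⁻ p∈
      ... | tri< τi<τj _ _ | i<j rewrite sort-< τi<τj | τ-involutive i | τ-involutive j = sort-< i<j
      ... | tri≈ _ τi≡τj _ | i<j = contradiction (τ-injective i j τi≡τj) (Fin.<⇒≢ i<j)
      ... | tri> _ _ τj<τi | i<j rewrite sort-> τj<τi | τ-involutive i | τ-involutive j = sort-> i<j

      reversal-∘ : ∀ {π} → IsPerm π → ∀ p → reversal (π ∘ τ) p ≈ reversal π (sortImage p) * reversal τ p
      reversal-∘ {π} π-injective (i , j) with Fin.<-cmp (τ i) (τ j)
      ... | tri< τi<τj _ _ rewrite sort-< τi<τj | dec-false (τ j <? τ i) (Fin.<-asym τi<τj) = sym (*-identityʳ _)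
      ... | tri≈ _ τi≡τj _ rewrite τ-injective i j τi≡τj | sort-diagonal (τ j) | reversal-diagonal (π ∘ τ) j
                                 | reversal-diagonal τ j = sym (*-identityʳ 1#)
      ... | tri> _ _ τj<τi rewrite sort-> τj<τi | dec-true (τ j <? τ i) τj<τi with Fin.<-cmp (π (τ i)) (π (τ j))
      ...   | tri< πτi<πτj _ _ rewrite dec-true (π (τ i) <? π (τ j)) πτi<πτj
                                     | dec-false (π (τ j) <? π (τ i)) (Fin.<-asym πτi<πτj) = sym -1*-1≈1
      ...   | tri≈ _ πτi≡πτj _ = contradiction (π-injective _ _ πτi≡πτj) (Fin.<⇒≢ τj<τi ∘ ≡.sym)
      ...   | tri> _ _ πτj<πτi rewrite dec-false (π (τ i) <? π (τ j)) (Fin.<-asym πτj<πτi)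
                                     | dec-true (π (τ j) <? π (τ i)) πτj<πτi = sym (*-identityˡ _)

      sgn-∘-involution : ∀ {π} → IsPerm π → sgn (π ∘ τ) ≈ sgn π * sgn τ
      sgn-∘-involution {π} π-injective = begin
        sgn (π ∘ τ)
          ≈⟨ sgn≈∏reversal (π ∘ τ) ⟩
        Π.foldMap (reversal (π ∘ τ)) ascendingPairs
          ≈⟨ Π.foldMap-cong (reversal-∘ π-injective) ascendingPairs ⟩
        Π.foldMap (λ p → reversal π (sortImage p) * reversal τ p) ascendingPairs
          ≈⟨ Π.foldMap-∙ _ _ ascendingPairs ⟩
        Π.foldMap (reversal π ∘ sortImage) ascendingPairs * Π.foldMap (reversal τ) ascendingPairs
          ≈⟨ *-congʳ (Π.foldMap-reindex (≡.setoid _) (reflexive ∘ ≡.cong (reversal π)) sortImage (≡.cong sortImage)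
                        ascendingPairs ascendingPairs-unique sortImage-ascending sortImage-involutive) ⟩
        Π.foldMap (reversal π) ascendingPairs * Π.foldMap (reversal τ) ascendingPairs
          ≈⟨ *-cong (sgn≈∏reversal π) (sgn≈∏reversal τ) ⟨
        sgn π * sgn τ ∎

    -- For a transposition, p ↦ sortImage p pairs up the reversed pairs two by two, leaving (k , l)
    -- as the only fixed reversal.
    module _ {k l : Fin r} (k<l : k < l) where
      private
        τ : Fin r → Fin r
        τ = transpose k l

        ρ : Fin r × Fin r → Fin r × Fin r
        ρ = sortImage τ (transpose-involutive k l)

        _≟₂_ : (p q : Fin r × Fin r) → Dec (p ≡ q)
        _≟₂_ = Productₚ.≡-dec Fin._≟_ Fin._≟_

        isTransposed : Fin r × Fin r → Carrier
        isTransposed p = if does (p ≟₂ (k , l)) then - 1# else 1#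

        isTransposed-kl : isTransposed (k , l) ≡ - 1#
        isTransposed-kl rewrite dec-true ((k , l) ≟₂ (k , l)) ≡.refl = ≡.refl

        isTransposed-other : ∀ {p} → p ≢ (k , l) → isTransposed p ≡ 1#
        isTransposed-other {p} p≢kl rewrite dec-false (p ≟₂ (k , l)) p≢kl = ≡.refl

        ρ-kl : ρ (k , l) ≡ (k , l)
        ρ-kl rewrite transpose-matchˡ k l | transpose-matchʳ k l = sort-> k<l

        transpose-swapped : ∀ {i j} → i < j → τ i ≡ j → τ j ≡ i → (i , j) ≡ (k , l)
        transpose-swapped {i} {j} i<j τi≡j τj≡i = cases (i Fin.≟ k) (i Fin.≟ l)
          where
          cases : Dec (i ≡ k) → Dec (i ≡ l) → (i , j) ≡ (k , l)
          cases (yes ≡.refl) _          = ≡.cong (i ,_) (≡.trans (≡.sym τi≡j) (transpose-matchˡ k l))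
          cases (no _)       (yes ≡.refl) =
            contradiction (≡.subst (i <_) (≡.trans (≡.sym τi≡j) (transpose-matchʳ k l)) i<j) (Fin.<-asym k<l)
          cases (no i≢k)     (no i≢l)   =
            contradiction (≡.trans (≡.sym (transpose-other i≢k i≢l)) τi≡j) (Fin.<⇒≢ i<j)

        fixed : ∀ {p} → p ∈ ascendingPairs → ρ p ≡ p → reversal τ p ≈ isTransposed p
        fixed {i , j} p∈ ρp≡p = reflexive (cases ((i , j) ≟₂ (k , l)))
          where
          cases : Dec ((i , j) ≡ (k , l)) → reversal τ (i , j) ≡ isTransposed (i , j)
          cases (yes ≡.refl) = ≡.trans (reversal-< τ k l (≡.subst₂ _<_ (≡.sym (transpose-matchʳ k l)) (≡.sym (transpose-matchˡ k l)) k<l))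
                                       (≡.sym isTransposed-kl)
          cases (no ij≢kl)   = ≡.trans (reversal-≮ τ i j λ τj<τi → ij≢kl (swapped τj<τi)) (≡.sym (isTransposed-other ij≢kl))
            where
            swapped : τ j < τ i → (i , j) ≡ (k , l)
            swapped τj<τi with Productₚ.,-injective (≡.trans (≡.sym (sort-> τj<τi)) ρp≡p)
            ... | τj≡i , τi≡j = transpose-swapped (∈-ascendingPairs⁻ p∈) τi≡j τj≡i

        paired : ∀ {p} → p ∈ ascendingPairs →
                 reversal τ p * reversal τ (ρ p) ≈ isTransposed p * isTransposed (ρ p)
        paired {i , j} p∈ = trans reversals≈1 (sym (cases ((i , j) ≟₂ (k , l))))
          where
          ττ-ascending : reversal (τ ∘ τ) (i , j) ≡ 1#
          ττ-ascending = reversal-≮ (τ ∘ τ) i j λ ττj<ττi →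
            Fin.<-asym (∈-ascendingPairs⁻ p∈) (≡.subst₂ _<_ (transpose-involutive k l j) (transpose-involutive k l i) ττj<ττi)
          reversals≈1 : reversal τ (i , j) * reversal τ (ρ (i , j)) ≈ 1#
          reversals≈1 = begin
            reversal τ (i , j) * reversal τ (ρ (i , j)) ≈⟨ *-comm _ _ ⟩
            reversal τ (ρ (i , j)) * reversal τ (i , j) ≈⟨ reversal-∘ τ (transpose-involutive k l)
                                                              (involution⇒IsPerm {τ = τ} (transpose-involutive k l)) (i , j) ⟨
            reversal (τ ∘ τ) (i , j)                    ≡⟨ ττ-ascending ⟩
            1#                                          ∎
          cases : Dec ((i , j) ≡ (k , l)) → isTransposed (i , j) * isTransposed (ρ (i , j)) ≈ 1#
          cases (yes ≡.refl) rewrite ρ-kl | isTransposed-kl = -1*-1≈1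
          cases (no ij≢kl) = trans (*-cong (reflexive (isTransposed-other ij≢kl)) (reflexive (isTransposed-other ρij≢kl)))
                                   (*-identityˡ 1#)
            where
            ρij≢kl : ρ (i , j) ≢ (k , l)
            ρij≢kl ρij≡kl = ij≢kl (≡.trans (≡.sym (sortImage-involutive τ (transpose-involutive k l) p∈))
                                           (≡.trans (≡.cong ρ ρij≡kl) ρ-kl))

      sgn-transpose : sgn (transpose k l) ≈ - 1#
      sgn-transpose = begin
        sgn τ                                       ≈⟨ sgn≈∏reversal τ ⟩
        Π.foldMap (reversal τ) ascendingPairs       ≈⟨ Π.foldMap-involution (≡.setoid _) (reflexive ∘ ≡.cong isTransposed)
                                                         (reflexive ∘ ≡.cong (reversal τ)) ρ (≡.cong ρ) ascendingPairs
                                                         ascendingPairs-unique (sortImage-ascending τ (transpose-involutive k l))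
                                                         (sortImage-involutive τ (transpose-involutive k l)) fixed paired ⟩
        Π.foldMap isTransposed ascendingPairs       ≈⟨ Π.foldMap-single (≡.setoid _) (reflexive ∘ ≡.cong isTransposed)
                                                         ascendingPairs-unique (∈-ascendingPairs k<l)
                                                         (λ _ p≢kl → reflexive (isTransposed-other p≢kl)) ⟩
        isTransposed (k , l)                        ≡⟨ isTransposed-kl ⟩
        - 1#                                        ∎

      sgn-∘-transpose< : ∀ {π} → IsPerm π → sgn (π ∘ transpose k l) ≈ - sgn π
      sgn-∘-transpose< {π} π-injective = begin
        sgn (π ∘ transpose k l)     ≈⟨ sgn-∘-involution (transpose k l) (transpose-involutive k l) π-injective ⟩
        sgn π * sgn (transpose k l) ≈⟨ *-congˡ sgn-transpose ⟩
        sgn π * - 1#                ≈⟨ *-comm _ _ ⟩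
        - 1# * sgn π                ≈⟨ -1*x≈-x (sgn π) ⟩
        - sgn π                     ∎

    sgn-∘-transpose : ∀ {π} → IsPerm π → ∀ {k l} → k ≢ l → sgn (π ∘ transpose k l) ≈ - sgn π
    sgn-∘-transpose {π} π-injective {k} {l} k≢l with Fin.<-cmp k l
    ... | tri< k<l _ _ = sgn-∘-transpose< k<l π-injective
    ... | tri≈ _ k≡l _ = contradiction k≡l k≢l
    ... | tri> _ _ l<k = trans (sgn-cong (≡.cong π ∘ transpose-comm k l)) (sgn-∘-transpose< l<k π-injective)

module LatticePaths where
  open Data.Integer using (_+_; _-_; _*_; -_; ∣_∣; _⊖_)
  open ≡ using (refl; sym; trans; cong; cong₂)
  open import Data.Integer.Tactic.RingSolver using (solve-∀)
  open import Data.Nat.Tactic.RingSolver using () renaming (solve-∀ to ℕ-solve-∀)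

  endpoint : ∀ {n} → ℤ → Path n → ℤ
  endpoint u []       = u
  endpoint u (b ∷ bs) = endpoint (step b u) bs

  last-trace : ∀ {n} u (p : Path n) → Vec.last (trace u p) ≡ endpoint u p
  last-trace u []           = refl
  last-trace u (b ∷ [])     = refl
  last-trace u (b ∷ c ∷ bs) = last-trace (step b u) (c ∷ bs)

  lookup-trace-zero : ∀ {n} u (p : Path n) → Vec.lookup (trace u p) zero ≡ u
  lookup-trace-zero u []      = refl
  lookup-trace-zero u (b ∷ p) = refl

  endAfter : ℤ → ℕ → ℕ → ℤ
  endAfter u n L = u + + n - (+ L + + L)

  endpoint-downs : ∀ {n} u (p : Path n) → endpoint u p ≡ endAfter u n (downs p)
  endpoint-downs u []                  = start u
    where
    start : ∀ u → u ≡ u + + 0 - (+ 0 + + 0)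
    start = solve-∀
  endpoint-downs {suc n} u (true ∷ p)  = trans (endpoint-downs (u + + 1) p) (up u (+ n) (+ downs p))
    where
    up : ∀ u n L → (u + + 1) + n - (L + L) ≡ u + (+ 1 + n) - (L + L)
    up = solve-∀
  endpoint-downs {suc n} u (false ∷ p) = trans (endpoint-downs (u - + 1) p) (down u (+ n) (+ downs p))
    where
    down : ∀ u n L → (u - + 1) + n - (L + L) ≡ u + (+ 1 + n) - ((+ 1 + L) + (+ 1 + L))
    down = solve-∀

  endAfter-bound : ∀ {a e N L} → L ℕ.≤ N → ∣ endAfter (+ a) N L - + e ∣ ℕ.≤ N ℕ.+ a ℕ.+ e
  endAfter-bound {a} {e} {N} {L} L≤N with N ℕ.∸ L | ℕ.m+[n∸m]≡n L≤N
  ... | d | refl = begin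
    ∣ endAfter (+ a) (L ℕ.+ d) L - + e ∣
      ≡⟨ cong ∣_∣ (trans (as-difference (+ a) (+ d) (+ L) (+ e)) (ℤ.m-n≡m⊖n (a ℕ.+ d) (L ℕ.+ e))) ⟩
    ∣ (a ℕ.+ d) ⊖ (L ℕ.+ e) ∣            ≤⟨ ℤ.∣m⊝n∣≤m⊔n (a ℕ.+ d) (L ℕ.+ e) ⟩
    (a ℕ.+ d) ℕ.⊔ (L ℕ.+ e)              ≤⟨ ℕ.m⊔n≤m+n (a ℕ.+ d) (L ℕ.+ e) ⟩
    (a ℕ.+ d) ℕ.+ (L ℕ.+ e)              ≡⟨ regroup a d L e ⟩
    L ℕ.+ d ℕ.+ a ℕ.+ e                  ∎
    where
    open ℕ.≤-Reasoning
    as-difference : ∀ a d L e → a + (L + d) - (L + L) - e ≡ (a + d) + - (L + e)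
    as-difference = solve-∀
    regroup : ∀ a d L e → (a ℕ.+ d) ℕ.+ (L ℕ.+ e) ≡ L ℕ.+ d ℕ.+ a ℕ.+ e
    regroup = ℕ-solve-∀

  offset-index : ∀ {o B} → ∣ o ∣ ℕ.≤ B → ∃ λ i → i ℕ.≤ 2 ℕ.* B × + i - + B ≡ o
  offset-index {o} {B} ∣o∣≤B =
    ∣ o + + B ∣ , index≤2B , trans (cong (_- + B) (ℤ.0≤i⇒+∣i∣≡i (nonNegative {o} ∣o∣≤B))) (cancel o (+ B))
    where
    nonNegative : ∀ {i} → ∣ i ∣ ℕ.≤ B → + 0 ℤ.≤ i + + B
    nonNegative {+ _}       _   = ℤ.+≤+ z≤n
    nonNegative { -[1+ _ ]} m<B rewrite ℤ.⊖-≥ m<B = ℤ.+≤+ z≤n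
    cancel : ∀ o b → o + b - b ≡ o
    cancel = solve-∀
    index≤2B : ∣ o + + B ∣ ℕ.≤ 2 ℕ.* B
    index≤2B = ℕ.≤-trans (ℤ.∣i+j∣≤∣i∣+∣j∣ o (+ B))
                         (≡.subst (∣ o ∣ ℕ.+ B ℕ.≤_) (cong (B ℕ.+_) (sym (ℕ.+-identityʳ B))) (ℕ.+-monoˡ-≤ B ∣o∣≤B))

  -- If p and q meet on the cylinder at time t, swapAt t p q starts like p and ends (on the
  -- cylinder) like q.
  swapAt : ∀ {n} → Fin (suc n) → Path n → Path n → Path n
  swapAt zero    p       q       = q
  swapAt (suc t) (b ∷ p) (c ∷ q) = b ∷ swapAt t p q

  swapAt-self : ∀ {n} (t : Fin (suc n)) p → swapAt t p p ≡ p
  swapAt-self zero    p       = refl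
  swapAt-self (suc t) (b ∷ p) = cong (b ∷_) (swapAt-self t p)

  swapAt-involutive : ∀ {n} (t : Fin (suc n)) p q → swapAt t (swapAt t p q) (swapAt t q p) ≡ p
  swapAt-involutive zero    p       q       = refl
  swapAt-involutive (suc t) (b ∷ p) (c ∷ q) = cong (b ∷_) (swapAt-involutive t p q)

  downs-swapAt : ∀ {n} (t : Fin (suc n)) p q → downs (swapAt t p q) ℕ.+ downs (swapAt t q p) ≡ downs p ℕ.+ downs q
  downs-swapAt zero    p           q           = ℕ.+-comm (downs q) (downs p)
  downs-swapAt (suc t) (true ∷ p)  (true ∷ q)  = downs-swapAt t p q
  downs-swapAt (suc t) (true ∷ p)  (false ∷ q) = trans (ℕ.+-suc _ _) (trans (cong suc (downs-swapAt t p q)) (sym (ℕ.+-suc _ _)))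
  downs-swapAt (suc t) (false ∷ p) (true ∷ q)  = cong suc (downs-swapAt t p q)
  downs-swapAt (suc t) (false ∷ p) (false ∷ q) =
    cong suc (trans (ℕ.+-suc _ _) (trans (cong suc (downs-swapAt t p q)) (sym (ℕ.+-suc _ _))))

  trace-swapAt-prefix : ∀ {n} {t t′ : Fin (suc n)} → t′ Fin.≤ t → ∀ u p q →
                        Vec.lookup (trace u (swapAt t p q)) t′ ≡ Vec.lookup (trace u p) t′
  trace-swapAt-prefix {t = zero}  {zero}   _         u p       q       = trans (lookup-trace-zero u q) (sym (lookup-trace-zero u p))
  trace-swapAt-prefix {t = suc t} {zero}   _         u (b ∷ p) (c ∷ q) = refl
  trace-swapAt-prefix {t = suc t} {suc t′} (s≤s t′≤t) u (b ∷ p) (c ∷ q) = trace-swapAt-prefix t′≤t (step b u) p q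

  endpoint-+ : ∀ {n} u d (p : Path n) → endpoint (u + d) p ≡ endpoint u p + d
  endpoint-+ u d []          = refl
  endpoint-+ u d (true ∷ p)  = trans (cong (λ v → endpoint v p) (comm u d)) (endpoint-+ (u + + 1) d p)
    where
    comm : ∀ u d → u + d + + 1 ≡ u + + 1 + d
    comm = solve-∀
  endpoint-+ u d (false ∷ p) = trans (cong (λ v → endpoint v p) (comm u d)) (endpoint-+ (u - + 1) d p)
    where
    comm : ∀ u d → u + d - + 1 ≡ u - + 1 + d
    comm = solve-∀

  endpoint-swapAt : ∀ {n} (t : Fin (suc n)) u v p q →
    endpoint u (swapAt t p q) + endpoint v (swapAt t q p) ≡ endpoint u p + endpoint v q
  endpoint-swapAt zero u v p q = begin
    endpoint u q + endpoint v p                           ≡⟨ cong₂ _+_ (rebase u v q) (rebase v u p) ⟩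
    (endpoint v q + (u - v)) + (endpoint u p + (v - u))   ≡⟨ cancel (endpoint v q) (endpoint u p) u v ⟩
    endpoint u p + endpoint v q                           ∎
    where
    open ≡.≡-Reasoning
    rebase : ∀ u v p → endpoint u p ≡ endpoint v p + (u - v)
    rebase u v p = trans (cong (λ w → endpoint w p) (split u v)) (endpoint-+ v (u - v) p)
      where
      split : ∀ u v → u ≡ v + (u - v)
      split = solve-∀
    cancel : ∀ a b u v → (a + (u - v)) + (b + (v - u)) ≡ b + a
    cancel = solve-∀
  endpoint-swapAt (suc t) u v (b ∷ p) (c ∷ q) = endpoint-swapAt t (step b u) (step c v) p q

open LatticePaths

module Residues (M : ℕ) .{{_ : NonZero M}} where
  open Cylinder M
  open Data.Integer using (_+_; _-_; _*_; _<_; ∣_∣)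
  open Data.Integer.DivMod using (a≡a%ℕn+[a/ℕn]*n; n%ℕd<d)
  open ≡ using (refl; sym; trans; cong)
  open import Data.Integer.Tactic.RingSolver using (solve-∀)
  open import Algebra.Properties.AbelianGroup ℤ.+-0-abelianGroup using (∙-cancelʳ)

  res<M : ∀ u → res u ℕ.< M
  res<M u = n%ℕd<d u M

  res-quotient : ∀ u → u ≡ + res u + (u /ℕ M) * + M
  res-quotient u = a≡a%ℕn+[a/ℕn]*n u M

  private
    quotient-≮ : ∀ {r r′ o o′} → r ℕ.< M → + r + o * + M ≡ + r′ + o′ * + M → ¬ o < o′
    quotient-≮ {r} {r′} {o} {o′} r<M eq o<o′ = ℤ.<-irrefl eq (begin-strict
      + r + o * + M <⟨ ℤ.+-monoˡ-< (o * + M) (ℤ.+<+ r<M) ⟩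
      + M + o * + M ≡⟨ sym (ℤ.suc-* o (+ M)) ⟩
      ℤ.suc o * + M ≤⟨ ℤ.*-monoʳ-≤-nonNeg (+ M) (ℤ.i<j⇒suc[i]≤j o<o′) ⟩
      o′ * + M      ≤⟨ ℤ.i≤j+i _ (+ r′) ⟩
      + r′ + o′ * + M ∎)
      where open ℤ.≤-Reasoning

  divMod-unique : ∀ {u r o} → r ℕ.< M → u ≡ + r + o * + M → res u ≡ r × u /ℕ M ≡ o
  divMod-unique {u} {r} {o} r<M u≡ = res≡r , sym o≡q
    where
    both : + r + o * + M ≡ + res u + (u /ℕ M) * + M
    both = trans (sym u≡) (res-quotient u)
    o≡q : o ≡ u /ℕ M
    o≡q with ℤ.<-cmp o (u /ℕ M)
    ... | tri< o<q _ _ = contradiction o<q (quotient-≮ r<M both)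
    ... | tri≈ _ o≡q _ = o≡q
    ... | tri> _ _ q<o = contradiction q<o (quotient-≮ (res<M u) (sym both))
    res≡r : res u ≡ r
    res≡r = ℤ.+-injective (∙-cancelʳ (o * + M) _ _ (trans (cong (λ q → + res u + q * + M) o≡q) (sym both)))

  ∣quotient∣≤∣difference∣ : ∀ {u e o} → u ≡ + e + o * + M → ∣ o ∣ ℕ.≤ ∣ u - + e ∣
  ∣quotient∣≤∣difference∣ {u} {e} {o} u≡ =
    ≡.subst (λ z → ∣ o ∣ ℕ.≤ ∣ z ∣) oM≡ (≡.subst (∣ o ∣ ℕ.≤_) (sym (ℤ.∣i*j∣≡∣i∣*∣j∣ o (+ M))) (ℕ.m≤m*n ∣ o ∣ M))
    where
    cancel : ∀ e m → e + m - e ≡ m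
    cancel = solve-∀
    oM≡ : o * + M ≡ u - + e
    oM≡ = sym (trans (cong (_- + e) u≡) (cancel (+ e) (o * + M)))

  res-+-multiple : ∀ u k → res (u + k * + M) ≡ res u
  res-+-multiple u k =
    proj₁ (divMod-unique {o = u /ℕ M + k} (res<M u) (trans (cong (_+ k * + M) (res-quotient u)) (shift (+ res u) (u /ℕ M) k (+ M))))
    where
    shift : ∀ r q k m → r + q * m + k * m ≡ r + (q + k) * m
    shift = solve-∀

  res-+-cong : ∀ {u v} d → res u ≡ res v → res (u + d) ≡ res (v + d)
  res-+-cong {u} {v} d res-u≡res-v = begin
    res (u + d)                          ≡⟨ reduce u ⟩
    res (+ res u + d)                    ≡⟨ cong (λ r → res (+ r + d)) res-u≡res-v ⟩
    res (+ res v + d)                    ≡⟨ reduce v ⟨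
    res (v + d)                          ∎
    where
    open ≡.≡-Reasoning
    regroup : ∀ r q d m → r + q * m + d ≡ (r + d) + q * m
    regroup = solve-∀
    reduce : ∀ w → res (w + d) ≡ res (+ res w + d)
    reduce w = trans (cong (λ w′ → res (w′ + d)) (res-quotient w))
                     (trans (cong res (regroup (+ res w) (w /ℕ M) d (+ M))) (res-+-multiple (+ res w + d) (w /ℕ M)))

  quotient-sum : ∀ {u₁ u₂ v₁ v₂} → u₁ + u₂ ≡ v₁ + v₂ → res u₁ ≡ res v₂ → res u₂ ≡ res v₁ →
                 u₁ /ℕ M + u₂ /ℕ M ≡ v₁ /ℕ M + v₂ /ℕ M
  quotient-sum {u₁} {u₂} {v₁} {v₂} sum≡ r₁≡ r₂≡ = ℤ.*-cancelʳ-≡ _ _ (+ M) (begin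
    (u₁ /ℕ M + u₂ /ℕ M) * + M          ≡⟨ quotients u₁ u₂ ⟩
    (u₁ + u₂) - (+ res u₁ + + res u₂)  ≡⟨ ≡.cong₂ _-_ sum≡ (≡.cong₂ (λ s t → + s + + t) r₁≡ r₂≡) ⟩
    (v₁ + v₂) - (+ res v₂ + + res v₁)  ≡⟨ cong (λ s → (v₁ + v₂) - s) (ℤ.+-comm (+ res v₂) (+ res v₁)) ⟩
    (v₁ + v₂) - (+ res v₁ + + res v₂)  ≡⟨ quotients v₁ v₂ ⟨
    (v₁ /ℕ M + v₂ /ℕ M) * + M          ∎)
    where
    open ≡.≡-Reasoning
    expand : ∀ r₁ r₂ q₁ q₂ m → (q₁ + q₂) * m ≡ ((r₁ + q₁ * m) + (r₂ + q₂ * m)) - (r₁ + r₂)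
    expand = solve-∀
    quotients : ∀ w₁ w₂ → (w₁ /ℕ M + w₂ /ℕ M) * + M ≡ (w₁ + w₂) - (+ res w₁ + + res w₂)
    quotients w₁ w₂ = trans (expand (+ res w₁) (+ res w₂) (w₁ /ℕ M) (w₂ /ℕ M) (+ M))
                            (cong (λ s → s - (+ res w₁ + + res w₂)) (sym (≡.cong₂ _+_ (res-quotient w₁) (res-quotient w₂))))

  res-step-cong : ∀ b {u v} → res u ≡ res v → res (step b u) ≡ res (step b v)
  res-step-cong true  {u} {v} = res-+-cong {u} {v} (+ 1)
  res-step-cong false {u} {v} = res-+-cong {u} {v} (ℤ.- + 1)

  res-endpoint-cong : ∀ {n} (p : Path n) {u v} → res u ≡ res v → res (endpoint u p) ≡ res (endpoint v p)
  res-endpoint-cong []      eq = eq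
  res-endpoint-cong (b ∷ p) eq = res-endpoint-cong p (res-step-cong b eq)

  res-endpoint-swapAt : ∀ {n} (t : Fin (suc n)) u v p q →
    res (Vec.lookup (trace u p) t) ≡ res (Vec.lookup (trace v q) t) → res (endpoint u (swapAt t p q)) ≡ res (endpoint v q)
  res-endpoint-swapAt zero    u v p       q       meet =
    res-endpoint-cong q (trans (cong res (sym (lookup-trace-zero u p))) (trans meet (cong res (lookup-trace-zero v q))))
  res-endpoint-swapAt (suc t) u v (b ∷ p) (c ∷ q) meet = res-endpoint-swapAt t (step b u) (step c v) p q meet


module _ {a p} {A : Set a} {P : Pred A p} (P? : Decidable P) where

  find-just : ∀ xs {x} → find P? xs ≡ just x → P x
  find-just (y ∷ xs) eq with P? y
  ... | yes py with eq
  ...   | ≡.refl = py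
  find-just (y ∷ xs) eq | no _ = find-just xs eq

  find-nothing : ∀ xs → find P? xs ≡ nothing → ∀ {x} → x ∈ xs → ¬ P x
  find-nothing (y ∷ xs) eq x∈ with P? y
  find-nothing (y ∷ xs) () x∈         | yes _
  find-nothing (y ∷ xs) eq (here ≡.refl) | no ¬py = ¬py
  find-nothing (y ∷ xs) eq (there x∈)  | no _   = find-nothing xs eq x∈

  find-cong : ∀ {q} {Q : Pred A q} (Q? : Decidable Q) → (∀ x → does (P? x) ≡ does (Q? x)) → ∀ xs → find P? xs ≡ find Q? xs
  find-cong Q? same []       = ≡.refl
  find-cong Q? same (x ∷ xs) with does (P? x) | does (Q? x) | same x
  ... | true  | true  | ≡.refl = ≡.refl
  ... | false | false | ≡.refl = find-cong Q? same xs

module FirstCollision {r : ℕ} where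

  Collide : (Fin r → ℕ) → Fin r × Fin r → Set
  Collide ρ (k , l) = k ≢ l × ρ k ≡ ρ l

  collide? : ∀ ρ → Decidable (Collide ρ)
  collide? ρ (k , l) = ¬? (k Fin.≟ l) ×-dec (ρ k ℕ.≟ ρ l)

  collide?-cong : ∀ {ρ ρ′} → (∀ k → ρ k ≡ ρ′ k) → ∀ kl → does (collide? ρ kl) ≡ does (collide? ρ′ kl)
  collide?-cong ρ≗ρ′ (k , l) rewrite ρ≗ρ′ k | ρ≗ρ′ l = ≡.refl

  Hit : ℕ → Set
  Hit n = Fin (suc n) × Fin r × Fin r

  -- ρ t k is the residue of walker k at time t.
  firstCollision : ∀ {n} → (Fin (suc n) → Fin r → ℕ) → Maybe (Hit n)
  firstCollision {zero}  ρ = Maybe.map (zero ,_) (find (collide? (ρ zero)) (pairs r))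
  firstCollision {suc n} ρ = Maybe.map (zero ,_) (find (collide? (ρ zero)) (pairs r))
                         <∣> Maybe.map (Product.map₁ suc) (firstCollision (λ t → ρ (suc t)))

  private
    now-cong : ∀ {ρ ρ′ : Fin r → ℕ} → (∀ k → ρ k ≡ ρ′ k) → find (collide? ρ) (pairs r) ≡ find (collide? ρ′) (pairs r)
    now-cong ρ≗ρ′ = find-cong (collide? _) (collide? _) (collide?-cong ρ≗ρ′) (pairs r)


  firstCollision-sound : ∀ {n} (ρ : Fin (suc n) → Fin r → ℕ) {t k l} →
                         firstCollision ρ ≡ just (t , k , l) → Collide (ρ t) (k , l)
  firstCollision-sound {zero}  ρ hit with find (collide? (ρ zero)) (pairs r) in now
  firstCollision-sound {zero}  ρ ≡.refl | just _ = find-just (collide? (ρ zero)) (pairs r) now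
  firstCollision-sound {suc n} ρ hit with find (collide? (ρ zero)) (pairs r) in now
  firstCollision-sound {suc n} ρ ≡.refl | just _ = find-just (collide? (ρ zero)) (pairs r) now
  ... | nothing with firstCollision (λ t → ρ (suc t)) in later
  firstCollision-sound {suc n} ρ ≡.refl | nothing | just _ = firstCollision-sound (λ t → ρ (suc t)) later

  firstCollision-complete : ∀ {n} (ρ : Fin (suc n) → Fin r → ℕ) → firstCollision ρ ≡ nothing →
                            ∀ t k l → ¬ Collide (ρ t) (k , l)
  firstCollision-complete {zero}  ρ none zero k l with find (collide? (ρ zero)) (pairs r) in now
  firstCollision-complete {zero}  ρ ≡.refl zero k l | nothing = find-nothing (collide? (ρ zero)) (pairs r) now (∈-pairs k l)
  firstCollision-complete {suc n} ρ none t k l with find (collide? (ρ zero)) (pairs r) in now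
  firstCollision-complete {suc n} ρ () t k l | just _
  ... | nothing with firstCollision (λ t → ρ (suc t)) in later
  firstCollision-complete {suc n} ρ () t k l | nothing | just _
  firstCollision-complete {suc n} ρ ≡.refl zero    k l | nothing | nothing = find-nothing (collide? (ρ zero)) (pairs r) now (∈-pairs k l)
  firstCollision-complete {suc n} ρ ≡.refl (suc t) k l | nothing | nothing = firstCollision-complete (λ t → ρ (suc t)) later t k l

  firstCollision-cong : ∀ {n} {ρ ρ′ : Fin (suc n) → Fin r → ℕ} → (∀ t k → ρ t k ≡ ρ′ t k) → firstCollision ρ ≡ firstCollision ρ′
  firstCollision-cong {zero}  ρ≗ρ′ = ≡.cong (Maybe.map (zero ,_)) (now-cong (ρ≗ρ′ zero))
  firstCollision-cong {suc n} ρ≗ρ′ = ≡.cong₂ _<∣>_ (≡.cong (Maybe.map (zero ,_)) (now-cong (ρ≗ρ′ zero)))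
                                                 (≡.cong (Maybe.map (Product.map₁ suc)) (firstCollision-cong (ρ≗ρ′ ∘ suc)))

  firstCollision-prefix : ∀ {n} {ρ ρ′ : Fin (suc n) → Fin r → ℕ} {t kl} → firstCollision ρ ≡ just (t , kl) →
                          (∀ t′ → t′ Fin.≤ t → ∀ k → ρ t′ k ≡ ρ′ t′ k) → firstCollision ρ′ ≡ just (t , kl)
  firstCollision-prefix {zero}  {ρ} {ρ′} hit agree rewrite now-cong (agree zero ℕ.z≤n) = hit
  firstCollision-prefix {suc n} {ρ} {ρ′} hit agree rewrite ≡.sym (now-cong (agree zero ℕ.z≤n))
    with find (collide? (ρ zero)) (pairs r)
  ... | just _  = hit
  ... | nothing with firstCollision (λ t → ρ (suc t)) in later
  firstCollision-prefix {suc n} {ρ} {ρ′} ≡.refl agree | nothing | just _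
    rewrite firstCollision-prefix later (λ t′ t′≤t → agree (suc t′) (ℕ.s≤s t′≤t)) = ≡.refl

module Powers {c ℓ : Level} (R : CommutativeRing c ℓ) (x y yinv : CommutativeRing.Carrier R) where
  open CommutativeRing R hiding (zero)
  open RingDefs R x y yinv
  open import Relation.Binary.Reasoning.Setoid setoid
  open import Algebra.Properties.CommutativeSemigroup *-commutativeSemigroup using (interchange)

  pow-+ : ∀ z m n → pow z (m ℕ.+ n) ≈ pow z m * pow z n
  pow-+ z zero    n = sym (*-identityˡ _)
  pow-+ z (suc m) n = trans (*-congˡ (pow-+ z m n)) (sym (*-assoc _ _ _))

  natR-+ : ∀ m n → natR (m ℕ.+ n) ≈ natR m + natR n
  natR-+ zero    n = sym (+-identityˡ _)
  natR-+ (suc m) n = trans (+-congˡ (natR-+ m n)) (sym (+-assoc _ _ _))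

  module _ (y*yinv≈1 : y * yinv ≈ 1#) where

    ypow-⊖ : ∀ m n → ypow (m ⊖ n) ≈ pow y m * pow yinv n
    ypow-⊖ m       zero    = sym (*-identityʳ _)
    ypow-⊖ zero    (suc n) = sym (*-identityˡ _)
    ypow-⊖ (suc m) (suc n) = begin
      ypow (suc m ⊖ suc n)               ≡⟨ ≡.cong ypow (ℤ.[1+m]⊖[1+n]≡m⊖n m n) ⟩
      ypow (m ⊖ n)                       ≈⟨ ypow-⊖ m n ⟩
      pow y m * pow yinv n               ≈⟨ *-identityˡ _ ⟨
      1# * (pow y m * pow yinv n)        ≈⟨ *-congʳ y*yinv≈1 ⟨
      (y * yinv) * (pow y m * pow yinv n) ≈⟨ interchange _ _ _ _ ⟩
      pow y (suc m) * pow yinv (suc n)   ∎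

    ypow-+ : ∀ u v → ypow (u ℤ.+ v) ≈ ypow u * ypow v
    ypow-+ (+ m)      (+ n)      = pow-+ y m n
    ypow-+ (+ m)      -[1+ n ]   = ypow-⊖ m (suc n)
    ypow-+ -[1+ m ]   (+ n)      = trans (ypow-⊖ n (suc m)) (*-comm _ _)
    ypow-+ -[1+ m ]   -[1+ n ]   = begin
      yinv * pow yinv (suc (m ℕ.+ n))    ≡⟨ ≡.cong (pow yinv) (ℕ.+-suc (suc m) n) ⟨
      pow yinv (suc m ℕ.+ suc n)         ≈⟨ pow-+ yinv (suc m) (suc n) ⟩
      pow yinv (suc m) * pow yinv (suc n) ∎

module FiniteSums {c ℓ : Level} (R : CommutativeRing c ℓ) (x y yinv : CommutativeRing.Carrier R) where
  open CommutativeRing R hiding (zero)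
  open RingDefs R x y yinv
  open Powers R x y yinv using (natR-+)
  open import Relation.Binary.Reasoning.Setoid setoid
  open import Algebra.Properties.CommutativeSemigroup +-commutativeSemigroup using (x∙yz≈xz∙y)
  open import Algebra.Properties.Semiring.Sum semiring using (sum-syntax; ∑-distrib-+; sum-cong-≋)
  module Σ = FoldMap +-commutativeMonoid

  sum-toℕ-zero : ∀ n (g : ℕ → Carrier) → (∀ i → i ℕ.< n → g i ≈ 0#) → ∑[ i < n ] g (toℕ i) ≈ 0#
  sum-toℕ-zero zero    g g≈0 = refl
  sum-toℕ-zero (suc n) g g≈0 =
    trans (+-cong (g≈0 0 (s≤s z≤n)) (sum-toℕ-zero n (g ∘ suc) λ i i<n → g≈0 (suc i) (s≤s i<n))) (+-identityˡ 0#)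

  sum-toℕ-single : ∀ {n k} (g : ℕ → Carrier) → k ℕ.< n → (∀ i → i ≢ k → g i ≈ 0#) → ∑[ i < n ] g (toℕ i) ≈ g k
  sum-toℕ-single {suc n} {zero}  g _         g≈0 =
    trans (+-congˡ (sum-toℕ-zero n (λ i → g (suc i)) λ i _ → g≈0 (suc i) λ ())) (+-identityʳ _)
  sum-toℕ-single {suc n} {suc k} g (s≤s k<n) g≈0 =
    trans (+-cong (g≈0 0 λ ()) (sum-toℕ-single (λ i → g (suc i)) k<n λ i i≢k → g≈0 (suc i) (i≢k ∘ ℕ.suc-injective)))
          (+-identityˡ _)

  sum-toℕ-init : ∀ n (g : ℕ → Carrier) → g n ≈ 0# → ∑[ i < suc n ] g (toℕ i) ≈ ∑[ i < n ] g (toℕ i)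
  sum-toℕ-init zero    g gn≈0 = trans (+-congʳ gn≈0) (+-identityˡ 0#)
  sum-toℕ-init (suc n) g gn≈0 = +-congˡ (sum-toℕ-init n (λ i → g (suc i)) gn≈0)

  foldMap-applyUpTo : ∀ (g : ℕ → Carrier) f n → Σ.foldMap g (applyUpTo f n) ≈ ∑[ i < n ] g (f (toℕ i))
  foldMap-applyUpTo g f zero    = refl
  foldMap-applyUpTo g f (suc n) = +-congˡ (foldMap-applyUpTo g (λ i → f (suc i)) n)

  foldMap-downs : ∀ N (φ : ℕ → Carrier) →
    Σ.foldMap (λ p → φ (downs p)) (allPaths N) ≈ ∑[ L < suc N ] (natR (N C toℕ L) * φ (toℕ L))
  foldMap-downs zero    φ = +-congʳ (sym (trans (*-congʳ (+-identityʳ 1#)) (*-identityˡ (φ 0))))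
  foldMap-downs (suc N) φ = begin
    Σ.foldMap (λ p → φ (downs p)) (map (true Vec.∷_) paths ++ (map (false Vec.∷_) paths ++ []))
      ≈⟨ trans (Σ.foldMap-++ _ (map (true Vec.∷_) paths) _)
               (+-congˡ (trans (Σ.foldMap-++ _ (map (false Vec.∷_) paths) []) (+-identityʳ _))) ⟩
    Σ.foldMap (λ p → φ (downs p)) (map (true Vec.∷_) paths) + Σ.foldMap (λ p → φ (downs p)) (map (false Vec.∷_) paths)
      ≡⟨ ≡.cong₂ _+_ (Σ.foldMap-map _ (true Vec.∷_) paths) (Σ.foldMap-map _ (false Vec.∷_) paths) ⟩
    Σ.foldMap (λ p → φ (downs p)) paths + Σ.foldMap (λ p → φ (suc (downs p))) paths
      ≈⟨ +-cong (foldMap-downs N φ) (foldMap-downs N (λ L → φ (suc L))) ⟩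
    (term 0 + ∑[ L < N ] shifted (toℕ L)) + ∑[ L < suc N ] (natR (N C toℕ L) * φ (suc (toℕ L)))
      ≈⟨ x∙yz≈xz∙y _ _ _ ⟨
    term 0 + (∑[ L < suc N ] (natR (N C toℕ L) * φ (suc (toℕ L))) + ∑[ L < N ] shifted (toℕ L))
      ≈⟨ +-congˡ (+-congˡ (sum-toℕ-init N shifted lastTerm≈0)) ⟨
    term 0 + (∑[ L < suc N ] (natR (N C toℕ L) * φ (suc (toℕ L))) + ∑[ L < suc N ] shifted (toℕ L))
      ≈⟨ +-congˡ (∑-distrib-+ {suc N} (λ L → natR (N C toℕ L) * φ (suc (toℕ L))) (λ L → shifted (toℕ L))) ⟨
    term 0 + ∑[ L < suc N ] (natR (N C toℕ L) * φ (suc (toℕ L)) + shifted (toℕ L))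
      ≈⟨ +-congˡ (sum-cong-≋ {suc N} λ L → pascal (toℕ L)) ⟩
    ∑[ L < suc (suc N) ] (natR (suc N C toℕ L) * φ (toℕ L)) ∎
    where
    paths = allPaths N
    term : ℕ → Carrier
    term L = natR (N C L) * φ L
    shifted : ℕ → Carrier
    shifted L = natR (N C suc L) * φ (suc L)
    lastTerm≈0 : shifted N ≈ 0#
    lastTerm≈0 = trans (*-congʳ (reflexive (≡.cong natR (k>n⇒nCk≡0 (ℕ.n<1+n N))))) (zeroˡ _)
    pascal : ∀ L → natR (N C L) * φ (suc L) + shifted L ≈ natR (suc N C suc L) * φ (suc L)
    pascal L = begin
      natR (N C L) * φ (suc L) + natR (N C suc L) * φ (suc L) ≈⟨ distribʳ _ _ _ ⟨
      (natR (N C L) + natR (N C suc L)) * φ (suc L)           ≈⟨ *-congʳ (natR-+ (N C L) (N C suc L)) ⟨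
      natR (N C L ℕ.+ N C suc L) * φ (suc L)                  ≡⟨ ≡.cong (λ n → natR n * φ (suc L)) (nCk+nC[k+1]≡[n+1]C[k+1] N L) ⟩
      natR (suc N C suc L) * φ (suc L)                        ∎

module Products {c ℓ : Level} (R : CommutativeRing c ℓ) (x y yinv : CommutativeRing.Carrier R) where
  open CommutativeRing R hiding (zero)
  open RingDefs R x y yinv
  open import Relation.Binary.Reasoning.Setoid setoid
  module Σ = FoldMap +-commutativeMonoid
  module ∏ = Algebra.Properties.CommutativeMonoid.Sum *-commutativeMonoid

  *-distribˡ-foldMap : ∀ {a} {A : Set a} z (f : A → Carrier) xs → z * Σ.foldMap f xs ≈ Σ.foldMap (λ u → z * f u) xs
  *-distribˡ-foldMap z f []       = zeroʳ z
  *-distribˡ-foldMap z f (u ∷ xs) = trans (distribˡ z (f u) _) (+-congˡ (*-distribˡ-foldMap z f xs))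

  *-distribʳ-foldMap : ∀ {a} {A : Set a} z (f : A → Carrier) xs → Σ.foldMap f xs * z ≈ Σ.foldMap (λ u → f u * z) xs
  *-distribʳ-foldMap z f xs =
    trans (*-comm _ z) (trans (*-distribˡ-foldMap z f xs) (Σ.foldMap-cong (λ u → *-comm z (f u)) xs))

  prodFin-cong : ∀ n {f g : Fin n → Carrier} → (∀ i → f i ≈ g i) → prodFin n f ≈ prodFin n g
  prodFin-cong zero    f≈g = refl
  prodFin-cong (suc n) f≈g = *-cong (f≈g zero) (prodFin-cong n (f≈g ∘ suc))

  prodFin-zero : ∀ {n} (f : Fin n → Carrier) i → f i ≈ 0# → prodFin n f ≈ 0#
  prodFin-zero f zero    fi≈0 = trans (*-congʳ fi≈0) (zeroˡ _)
  prodFin-zero f (suc i) fi≈0 = trans (*-congˡ (prodFin-zero (f ∘ suc) i fi≈0)) (zeroʳ _)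

  prodFin≡product : ∀ n (f : Fin n → Carrier) → prodFin n f ≡ ∏.sum f
  prodFin≡product zero    f = ≡.refl
  prodFin≡product (suc n) f = ≡.cong (f zero *_) (prodFin≡product n (f ∘ suc))

  prodFin-if : ∀ n {p} {P : Fin n → Set p} (P? : ∀ i → Dec (P i)) (w : Fin n → Carrier) →
    prodFin n (λ i → if does (P? i) then w i else 0#) ≈ (if does (Fin.all? P?) then prodFin n w else 0#)
  prodFin-if n {P = P} P? w = cases (Fin.all? P?)
    where
    cases : Dec (∀ i → P i) → prodFin n (λ i → if does (P? i) then w i else 0#) ≈ (if does (Fin.all? P?) then prodFin n w else 0#)
    cases (yes all) rewrite dec-true (Fin.all? P?) all =
      prodFin-cong n λ i → reflexive (≡.cong (if_then w i else 0#) (dec-true (P? i) (all i)))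
    cases (no ¬all) rewrite dec-false (Fin.all? P?) ¬all with Fin.¬∀⟶∃¬ n _ P? ¬all
    ... | i , ¬Pi = prodFin-zero _ i (reflexive (≡.cong (if_then w i else 0#) (dec-false (P? i) ¬Pi)))

  prodFin-pair : ∀ {n} {k l : Fin n} → k ≢ l → (f g : Fin n → Carrier) →
    (∀ i → i ≢ k → i ≢ l → g i ≈ f i) → g k * g l ≈ f k * f l → prodFin n g ≈ prodFin n f
  prodFin-pair {suc zero}    {zero} {zero} k≢l = contradiction ≡.refl k≢l
  prodFin-pair {suc (suc n)} {k} {l} k≢l f g g≈f gkl≈fkl = begin
    prodFin _ g                              ≡⟨ prodFin≡product _ g ⟩
    ∏.sum g                                  ≈⟨ extract g ⟩
    g k * (g l * ∏.sum (rest g))             ≈⟨ *-assoc _ _ _ ⟨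
    (g k * g l) * ∏.sum (rest g)             ≈⟨ *-cong gkl≈fkl (∏.sum-cong-≋ λ i → g≈f _ (punchInᵢ≢k i) (punchInᵢ≢l i)) ⟩
    (f k * f l) * ∏.sum (rest f)             ≈⟨ *-assoc _ _ _ ⟩
    f k * (f l * ∏.sum (rest f))             ≈⟨ extract f ⟨
    ∏.sum f                                  ≡⟨ prodFin≡product _ f ⟨
    prodFin _ f                              ∎
    where
    j = punchOut k≢l
    rest : (Fin (suc (suc n)) → Carrier) → Fin n → Carrier
    rest h = removeAt (removeAt h k) j
    extract : ∀ h → ∏.sum h ≈ h k * (h l * ∏.sum (rest h))
    extract h = trans (∏.sum-remove {i = k} h)
      (*-congˡ (trans (∏.sum-remove {i = j} (removeAt h k)) (*-congʳ (reflexive (≡.cong h (Fin.punchIn-punchOut k≢l))))))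
    punchInᵢ≢k : ∀ i → punchIn k (punchIn j i) ≢ k
    punchInᵢ≢k i = Fin.punchInᵢ≢i k (punchIn j i)
    punchInᵢ≢l : ∀ i → punchIn k (punchIn j i) ≢ l
    punchInᵢ≢l i eq = Fin.punchInᵢ≢i j i
      (Fin.punchIn-injective k _ _ (≡.trans eq (≡.sym (Fin.punchIn-punchOut k≢l))))

  prodFin-foldMap : ∀ {a} {A : Set a} n (h : Fin n → A → Carrier) (xs : List A) →
    prodFin n (λ i → Σ.foldMap (h i) xs) ≈ Σ.foldMap (λ P → prodFin n (λ i → h i (P i))) (allFun n xs)
  prodFin-foldMap zero    h xs = sym (+-identityʳ 1#)
  prodFin-foldMap (suc n) h xs =
    trans (*-congˡ (prodFin-foldMap n (h ∘ suc) xs))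
    (trans (*-distribʳ-foldMap _ (h zero) xs)
    (trans (Σ.foldMap-cong (λ u → *-distribˡ-foldMap (h zero u) _ (allFun n xs)) xs)
    (trans (sym (Σ.foldMap-cartesianProductWith (λ P → prodFin (suc n) (λ i → h i (P i))) _ xs (allFun n xs)))
           (reflexive (≡.cong (Σ.foldMap _) (≡.sym (concatMap-map≡cartesianProductWith _ xs (allFun n xs))))))))

module PathGeneratingFunction {c ℓ : Level} (R : CommutativeRing c ℓ) (x y yinv : CommutativeRing.Carrier R)
                              (M : ℕ) .{{_ : NonZero M}} where
  open CommutativeRing R hiding (zero)
  open RingDefs R x y yinv
  open Cylinder M
  open Residues M
  open FiniteSums R x y yinv
  open import Algebra.Properties.Semiring.Sum semiring using (sum-syntax; ∑-comm; sum-cong-≋)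
  open import Relation.Binary.Reasoning.Setoid setoid
  open import Data.Integer.Tactic.RingSolver using (solve-∀)
  open import Algebra.Properties.AbelianGroup ℤ.+-0-abelianGroup using (∙-cancelʳ)
  open import Data.Nat.DivMod using (_/_; _%_; m*n%n≡0; m*n/n≡m; m≡m%n+[m/n]*n)

  weightEndingAt : ∀ {N} → ℕ → ℕ → Path N → Carrier
  weightEndingAt a e p = if does (endRes a p ℕ.≟ e) then weight M a p else 0#

  private
    double≡*2 : ∀ L → L ℕ.+ L ≡ L ℕ.* 2
    double≡*2 L = ≡.trans (≡.cong (L ℕ.+_) (≡.sym (ℕ.+-identityʳ L))) (ℕ.*-comm 2 L)

    double-even : ∀ L → (L ℕ.+ L) % 2 ≡ 0
    double-even L = ≡.trans (≡.cong (_% 2) (double≡*2 L)) (m*n%n≡0 L 2)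

    double-half : ∀ L → (L ℕ.+ L) / 2 ≡ L
    double-half L = ≡.trans (≡.cong (_/ 2) (double≡*2 L)) (m*n/n≡m L 2)

    even-half : ∀ {s} → s % 2 ≡ 0 → s ≡ s / 2 ℕ.+ s / 2
    even-half {s} even = ≡.trans (m≡m%n+[m/n]*n s 2) (≡.trans (≡.cong (ℕ._+ s / 2 ℕ.* 2) even) (≡.sym (double≡*2 (s / 2))))

  -- The exponent s of qTerm o equals 2L
  -- exactly when E L ≡ e + o M, so qTerm o splits into contributions indexed by L; exchanging
  -- the two sums leaves, for each L, only the offset o = E L / M, which lies in the range [-B, B]
  -- summed over by q.
  module _ (N a e : ℕ) where
    private
      B : ℕ
      B = N ℕ.+ a ℕ.+ e

      E : ℕ → ℤ
      E L = endAfter (+ a) N L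

      contribution : ℤ → ℕ → Carrier
      contribution o L = if does (E L ℤ.≟ + e ℤ.+ o ℤ.* + M) then natR (N C L) * ypow o * pow x L else 0#

      contribution-miss : ∀ {o L} → E L ≢ + e ℤ.+ o ℤ.* + M → contribution o L ≈ 0#
      contribution-miss {o} {L} miss rewrite dec-false (E L ℤ.≟ + e ℤ.+ o ℤ.* + M) miss = refl

      contribution-hit : ∀ {o L} → E L ≡ + e ℤ.+ o ℤ.* + M → contribution o L ≈ natR (N C L) * ypow o * pow x L
      contribution-hit {o} {L} hit rewrite dec-true (E L ℤ.≟ + e ℤ.+ o ℤ.* + M) hit = refl

      weightByDowns : ℕ → Carrier
      weightByDowns L = if does (res (E L) ℕ.≟ e) then ypow (E L /ℕ M) * pow x L else 0#

      exponent : ℤ → ℤ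
      exponent o = + N ℤ.- + e ℤ.- o ℤ.* + M ℤ.+ + a

      exponent-split : ∀ o L → exponent o ≡ (E L ℤ.- (+ e ℤ.+ o ℤ.* + M)) ℤ.+ (+ L ℤ.+ + L)
      exponent-split o L = split (+ N) (+ e) o (+ M) (+ a) (+ L)
        where
        split : ∀ n e o m a L → n ℤ.- e ℤ.- o ℤ.* m ℤ.+ a ≡ ((a ℤ.+ n ℤ.- (L ℤ.+ L)) ℤ.- (e ℤ.+ o ℤ.* m)) ℤ.+ (L ℤ.+ L)
        split = solve-∀

      exponent-hit : ∀ {o L} → E L ≡ + e ℤ.+ o ℤ.* + M → exponent o ≡ + (L ℕ.+ L)
      exponent-hit {o} {L} hit = ≡.trans (exponent-split o L)
        (≡.trans (≡.cong (ℤ._+ + (L ℕ.+ L)) (ℤ.i≡j⇒i-j≡0 hit)) (ℤ.+-identityˡ _))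

      exponent-hit⁻ : ∀ {o L} → exponent o ≡ + (L ℕ.+ L) → E L ≡ + e ℤ.+ o ℤ.* + M
      exponent-hit⁻ {o} {L} eq = ℤ.i-j≡0⇒i≡j _ _
        (∙-cancelʳ (+ (L ℕ.+ L)) _ _ (≡.trans (≡.sym (exponent-split o L)) (≡.trans eq (≡.sym (ℤ.+-identityˡ _)))))

      qTerm-parity : ∀ {o s} → exponent o ≡ + s → (even? : Dec (s % 2 ≡ 0)) →
        (if does even? then natR (N C (s / 2)) * ypow o * pow x (s / 2) else 0#) ≈ ∑[ L < suc N ] contribution o (toℕ L)
      qTerm-parity {o} {s} eq (no odd) = sym (sum-toℕ-zero (suc N) (contribution o) λ L _ → contribution-miss {o} {L} λ hit →
        odd (≡.subst (λ t → t % 2 ≡ 0) (ℤ.+-injective (≡.trans (≡.sym (exponent-hit {o} {L} hit)) eq)) (double-even L)))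
      qTerm-parity {o} {s} eq (yes even) with s / 2 ℕ.≤? N
      ... | yes half≤N = sym (trans (sum-toℕ-single (contribution o) (s≤s half≤N) others)
                                    (contribution-hit {o} {s / 2} (exponent-hit⁻ {o} {s / 2} (≡.trans eq (≡.cong +_ (even-half even))))))
        where
        others : ∀ L → L ≢ s / 2 → contribution o L ≈ 0#
        others L L≢half = contribution-miss {o} {L} λ hit → L≢half
          (≡.trans (≡.sym (double-half L)) (≡.cong (_/ 2) (ℤ.+-injective (≡.trans (≡.sym (exponent-hit {o} {L} hit)) eq))))
      ... | no half≰N = trans (trans (*-congʳ (*-congʳ (reflexive (≡.cong natR (k>n⇒nCk≡0 (ℕ.≰⇒> half≰N))))))
                                     (trans (*-congʳ (zeroˡ _)) (zeroˡ _)))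
                              (sym (sum-toℕ-zero (suc N) (contribution o) λ L L<1+N → contribution-miss {o} {L} λ hit →
                                 half≰N (≡.subst (ℕ._≤ N) (half≡ hit) (ℕ.≤-pred L<1+N))))
        where
        half≡ : ∀ {L} → E L ≡ + e ℤ.+ o ℤ.* + M → L ≡ s / 2
        half≡ {L} hit = ≡.trans (≡.sym (double-half L)) (≡.cong (_/ 2) (ℤ.+-injective (≡.trans (≡.sym (exponent-hit {o} {L} hit)) eq)))

      qTerm≈∑contribution : ∀ o → qTerm M N (+ a) (+ e) o ≈ ∑[ L < suc N ] contribution o (toℕ L)
      qTerm≈∑contribution o with + N ℤ.- + e ℤ.- o ℤ.* + M ℤ.+ + a in eq
      ... | -[1+ _ ] = sym (sum-toℕ-zero (suc N) (contribution o) λ L _ → contribution-miss {o} {L} λ hit →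
                         case (≡.trans (≡.sym eq) (exponent-hit {o} {L} hit)))
        where case : ∀ {m n} → -[1+ m ] ≢ + n
              case ()
      ... | + s      = qTerm-parity {o} eq (s % 2 ℕ.≟ 0)

      weightByDowns-miss : ∀ {L} → res (E L) ≢ e → weightByDowns L ≈ 0#
      weightByDowns-miss {L} miss rewrite dec-false (res (E L) ℕ.≟ e) miss = refl

      weightByDowns-hit : ∀ {L} → res (E L) ≡ e → weightByDowns L ≈ ypow (E L /ℕ M) * pow x L
      weightByDowns-hit {L} hit rewrite dec-true (res (E L) ℕ.≟ e) hit = refl

      decomposition : ∀ {L} → res (E L) ≡ e → E L ≡ + e ℤ.+ (E L /ℕ M) ℤ.* + M
      decomposition {L} res≡e = ≡.subst (λ r → E L ≡ + r ℤ.+ (E L /ℕ M) ℤ.* + M) res≡e (res-quotient (E L))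

      ∑contribution≈weightByDowns : e ℕ.< M → ∀ L → L ℕ.≤ N →
        ∑[ i < suc (2 ℕ.* B) ] contribution (+ toℕ i ℤ.- + B) L ≈ natR (N C L) * weightByDowns L
      ∑contribution≈weightByDowns e<M L L≤N with res (E L) ℕ.≟ e
      ... | no res≢e = trans (sum-toℕ-zero (suc (2 ℕ.* B)) (λ i → contribution (+ i ℤ.- + B) L) λ i _ →
                               contribution-miss {+ i ℤ.- + B} {L} λ hit → res≢e (proj₁ (divMod-unique {o = + i ℤ.- + B} e<M hit)))
                             (sym (trans (*-congˡ (weightByDowns-miss {L} res≢e)) (zeroʳ _)))
      ... | yes res≡e with offset-index (ℕ.≤-trans (∣quotient∣≤∣difference∣ {o = E L /ℕ M} (decomposition {L} res≡e)) (endAfter-bound L≤N))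
      ... | i* , i*≤2B , i*-offset = begin
        ∑[ i < suc (2 ℕ.* B) ] contribution (+ toℕ i ℤ.- + B) L ≈⟨ sum-toℕ-single (λ i → contribution (+ i ℤ.- + B) L) (s≤s i*≤2B) others ⟩
        contribution (+ i* ℤ.- + B) L                          ≡⟨ ≡.cong (λ o → contribution o L) i*-offset ⟩
        contribution (E L /ℕ M) L                              ≈⟨ contribution-hit {E L /ℕ M} {L} (decomposition {L} res≡e) ⟩
        natR (N C L) * ypow (E L /ℕ M) * pow x L               ≈⟨ *-assoc _ _ _ ⟩
        natR (N C L) * (ypow (E L /ℕ M) * pow x L)             ≈⟨ *-congˡ (weightByDowns-hit {L} res≡e) ⟨
        natR (N C L) * weightByDowns L                         ∎
        where
        others : ∀ i → i ≢ i* → contribution (+ i ℤ.- + B) L ≈ 0#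
        others i i≢i* = contribution-miss {+ i ℤ.- + B} {L} λ hit → i≢i* (ℤ.+-injective (∙-cancelʳ (ℤ.- + B) (+ i) (+ i*)
          (≡.trans (≡.sym (proj₂ (divMod-unique {o = + i ℤ.- + B} e<M hit))) (≡.sym i*-offset))))

      weightEndingAt≡weightByDowns : ∀ (p : Path N) → weightEndingAt a e p ≡ weightByDowns (downs p)
      weightEndingAt≡weightByDowns p rewrite last-trace (+ a) p | endpoint-downs (+ a) p = ≡.refl

    q≈foldMap-weightEndingAt : e ℕ.< M → q M N (+ a) (+ e) ≈ Σ.foldMap (weightEndingAt a e) (allPaths N)
    q≈foldMap-weightEndingAt e<M = begin
      q M N (+ a) (+ e)
        ≈⟨ foldMap-applyUpTo _ (λ i → i) (suc (2 ℕ.* B)) ⟩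
      ∑[ i < suc (2 ℕ.* B) ] qTerm M N (+ a) (+ e) (+ toℕ i ℤ.- + B)
        ≈⟨ sum-cong-≋ {suc (2 ℕ.* B)} (λ i → qTerm≈∑contribution (+ toℕ i ℤ.- + B)) ⟩
      ∑[ i < suc (2 ℕ.* B) ] ∑[ L < suc N ] contribution (+ toℕ i ℤ.- + B) (toℕ L)
        ≈⟨ ∑-comm {suc (2 ℕ.* B)} {suc N} (λ i L → contribution (+ toℕ i ℤ.- + B) (toℕ L)) ⟩
      ∑[ L < suc N ] ∑[ i < suc (2 ℕ.* B) ] contribution (+ toℕ i ℤ.- + B) (toℕ L)
        ≈⟨ sum-cong-≋ {suc N} (λ L → ∑contribution≈weightByDowns e<M (toℕ L) (ℕ.≤-pred (Fin.toℕ<n L))) ⟩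
      ∑[ L < suc N ] (natR (N C toℕ L) * weightByDowns (toℕ L))
        ≈⟨ foldMap-downs N weightByDowns ⟨
      Σ.foldMap (λ p → weightByDowns (downs p)) (allPaths N)
        ≈⟨ Σ.foldMap-cong (λ p → reflexive (weightEndingAt≡weightByDowns p)) (allPaths N) ⟨
      Σ.foldMap (weightEndingAt a e) (allPaths N) ∎

module Weights {c ℓ : Level} (R : CommutativeRing c ℓ) (x y yinv : CommutativeRing.Carrier R)
               (y*yinv≈1 : CommutativeRing._≈_ R (CommutativeRing._*_ R y yinv) (CommutativeRing.1# R))
               (M : ℕ) .{{_ : NonZero M}} where
  open CommutativeRing R hiding (zero)
  open RingDefs R x y yinv
  open Cylinder M
  open Residues M
  open Powers R x y yinv using (pow-+; ypow-+)
  open import Relation.Binary.Reasoning.Setoid setoid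
  open import Algebra.Properties.CommutativeSemigroup *-commutativeSemigroup using (interchange)

  offset-endpoint : ∀ {n} a (p : Path n) → offset a p ≡ endpoint (+ a) p /ℕ M
  offset-endpoint a p = ≡.cong (_/ℕ M) (last-trace (+ a) p)

  offset-swapAt : ∀ {n} (t : Fin (suc n)) a b p q →
    res (Vec.lookup (trace (+ a) p) t) ≡ res (Vec.lookup (trace (+ b) q) t) →
    offset a (swapAt t p q) ℤ.+ offset b (swapAt t q p) ≡ offset a p ℤ.+ offset b q
  offset-swapAt t a b p q meet =
    ≡.trans (≡.cong₂ ℤ._+_ (offset-endpoint a (swapAt t p q)) (offset-endpoint b (swapAt t q p)))
      (≡.trans (quotient-sum {endpoint (+ a) (swapAt t p q)} {endpoint (+ b) (swapAt t q p)} {endpoint (+ a) p} {endpoint (+ b) q}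
                             (endpoint-swapAt t (+ a) (+ b) p q) (res-endpoint-swapAt t (+ a) (+ b) p q meet)
                             (res-endpoint-swapAt t (+ b) (+ a) q p (≡.sym meet)))
               (≡.sym (≡.cong₂ ℤ._+_ (offset-endpoint a p) (offset-endpoint b q))))

  weight-swapAt : ∀ {n} (t : Fin (suc n)) a b p q →
    res (Vec.lookup (trace (+ a) p) t) ≡ res (Vec.lookup (trace (+ b) q) t) →
    weight M a (swapAt t p q) * weight M b (swapAt t q p) ≈ weight M a p * weight M b q
  weight-swapAt t a b p q meet = begin
    (ypow o₁ * pow x d₁) * (ypow o₂ * pow x d₂)   ≈⟨ interchange _ _ _ _ ⟩
    (ypow o₁ * ypow o₂) * (pow x d₁ * pow x d₂)   ≈⟨ *-cong (ypow-+ y*yinv≈1 o₁ o₂) (pow-+ x d₁ d₂) ⟨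
    ypow (o₁ ℤ.+ o₂) * pow x (d₁ ℕ.+ d₂)          ≡⟨ ≡.cong₂ (λ o d → ypow o * pow x d) (offset-swapAt t a b p q meet) (downs-swapAt t p q) ⟩
    ypow (o₃ ℤ.+ o₄) * pow x (d₃ ℕ.+ d₄)          ≈⟨ *-cong (ypow-+ y*yinv≈1 o₃ o₄) (pow-+ x d₃ d₄) ⟩
    (ypow o₃ * ypow o₄) * (pow x d₃ * pow x d₄)   ≈⟨ interchange _ _ _ _ ⟩
    (ypow o₃ * pow x d₃) * (ypow o₄ * pow x d₄)   ∎
    where
    o₁ = offset a (swapAt t p q)
    o₂ = offset b (swapAt t q p)
    o₃ = offset a p
    o₄ = offset b q
    d₁ = downs (swapAt t p q)
    d₂ = downs (swapAt t q p)
    d₃ = downs p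
    d₄ = downs q

module LGV {c ℓ : Level} (R : CommutativeRing c ℓ) (x y yinv : CommutativeRing.Carrier R)
           (y*yinv≈1 : CommutativeRing._≈_ R (CommutativeRing._*_ R y yinv) (CommutativeRing.1# R))
           (M : ℕ) .{{_ : NonZero M}} (N r : ℕ) (a e : Fin r → ℕ) where
  open CommutativeRing R hiding (zero)
  open RingDefs R x y yinv
  open Cylinder M
  open Residues M
  open FirstCollision {r}
  open Sign R x y yinv using (sgn-cong; sgn-∘-transpose)
  open Products R x y yinv using (prodFin-cong; prodFin-pair)
  open Weights R x y yinv y*yinv≈1 M using (weight-swapAt)
  open import Algebra.Properties.Ring ring using (-‿distribˡ-*)
  module Σ = FoldMap +-commutativeMonoid

  Family : Set
  Family = Fin r → Path N

  families : List Family
  families = allFun r (allPaths N)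

  familyWeight : Family → Carrier
  familyWeight P = prodFin r (λ k → weight M (a k) (P k))

  residues : Family → Fin (suc N) → Fin r → ℕ
  residues P t k = res (Vec.lookup (trace (+ a k) (P k)) t)

  swapFamily : Fin (suc N) → Fin r → Fin r → Family → Family
  swapFamily t k l P i = swapAt t (P i) (P (transpose k l i))

  Config : Set
  Config = (Fin r → Fin r) × Family

  Configs : Setoid _ _
  Configs = (Fin r →-setoid Fin r) ×ₛ (Fin r →-setoid Path N)

  open Setoid Configs using () renaming (_≈_ to _≃_; reflexive to ≃-reflexive; trans to ≃-trans)
  open MemS Configs using () renaming (_∈_ to _∈ᶜ_)

  Bad : Config → Set
  Bad (π , P) = EndsAt a e π P × ¬ NonIntersecting a P

  bad? : Decidable Bad
  bad? (π , P) = endsAt? a e π P ×-dec ¬? (nonIntersecting? a P)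

  badConfigs : List Config
  badConfigs = filter bad? (cartesianProduct (perms r) families)

  signedWeight : Config → Carrier
  signedWeight (π , P) = sgn π * familyWeight P

  applyCollision : Maybe (Hit N) → Config → Config
  applyCollision (just (t , k , l)) (π , P) = π ∘ transpose k l , swapFamily t k l P
  applyCollision nothing            z       = z

  involution : Config → Config
  involution (π , P) = applyCollision (firstCollision (residues P)) (π , P)

  residues-cong : ∀ {P P′ : Family} → (∀ k → P k ≡ P′ k) → ∀ t k → residues P t k ≡ residues P′ t k
  residues-cong P≗P′ t k = ≡.cong (λ p → res (Vec.lookup (trace (+ a k) p) t)) (P≗P′ k)

  collision : ∀ {P} → ¬ NonIntersecting a P → ∃ λ (h : Hit N) → firstCollision (residues P) ≡ just h
  collision {P} intersecting with firstCollision (residues P) in none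
  ... | just h  = h , ≡.refl
  ... | nothing = contradiction (λ k l k≢l t meet → firstCollision-complete (residues P) none t k l (k≢l , meet)) intersecting

  module _ {P : Family} {t k l} (hit : firstCollision (residues P) ≡ just (t , k , l)) where

    k≢l : k ≢ l
    k≢l = proj₁ (firstCollision-sound (residues P) hit)

    meet-transpose : ∀ i → residues P t i ≡ residues P t (transpose k l i)
    meet-transpose i = cases (i Fin.≟ k) (i Fin.≟ l)
      where
      meet = proj₂ (firstCollision-sound (residues P) hit)
      cases : Dec (i ≡ k) → Dec (i ≡ l) → residues P t i ≡ residues P t (transpose k l i)
      cases (yes ≡.refl) _          = ≡.trans meet (≡.cong (residues P t) (≡.sym (transpose-matchˡ i l)))
      cases (no _)       (yes ≡.refl) = ≡.trans (≡.sym meet) (≡.cong (residues P t) (≡.sym (transpose-matchʳ k i)))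
      cases (no i≢k)     (no i≢l)   = ≡.cong (residues P t) (≡.sym (transpose-other i≢k i≢l))

    swapFamily-hit : firstCollision (residues (swapFamily t k l P)) ≡ just (t , k , l)
    swapFamily-hit = firstCollision-prefix hit λ t′ t′≤t i →
      ≡.sym (≡.cong res (trace-swapAt-prefix t′≤t (+ a i) (P i) (P (transpose k l i))))

    swapFamily-involutive : ∀ i → swapFamily t k l (swapFamily t k l P) i ≡ P i
    swapFamily-involutive i =
      ≡.trans (≡.cong (λ j → swapAt t (swapAt t (P i) (P (transpose k l i))) (swapAt t (P (transpose k l i)) (P j)))
                      (transpose-involutive k l i))
              (swapAt-involutive t (P i) (P (transpose k l i)))

    swapFamily-endsAt : ∀ {π} → EndsAt a e π P → EndsAt a e (π ∘ transpose k l) (swapFamily t k l P)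
    swapFamily-endsAt ends i = ≡.trans (≡.cong res (last-trace (+ a i) (swapFamily t k l P i)))
      (≡.trans (res-endpoint-swapAt t (+ a i) (+ a (transpose k l i)) (P i) (P (transpose k l i)) (meet-transpose i))
      (≡.trans (≡.cong res (≡.sym (last-trace (+ a (transpose k l i)) (P (transpose k l i))))) (ends (transpose k l i))))

    familyWeight-swapFamily : familyWeight (swapFamily t k l P) ≈ familyWeight P
    familyWeight-swapFamily = prodFin-pair k≢l (λ i → weight M (a i) (P i)) (λ i → weight M (a i) (swapFamily t k l P i))
      (λ i i≢k i≢l → reflexive (≡.cong (weight M (a i))
        (≡.trans (≡.cong (swapAt t (P i) ∘ P) (transpose-other i≢k i≢l)) (swapAt-self t (P i)))))
      (trans (*-cong (reflexive (≡.cong (λ j → weight M (a k) (swapAt t (P k) (P j))) (transpose-matchˡ k l)))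
                     (reflexive (≡.cong (λ j → weight M (a l) (swapAt t (P l) (P j))) (transpose-matchʳ k l))))
             (weight-swapAt t (a k) (a l) (P k) (P l) (proj₂ (firstCollision-sound (residues P) hit))))

    involution-hit : ∀ {π} → involution (π , P) ≡ (π ∘ transpose k l , swapFamily t k l P)
    involution-hit {π} = ≡.cong (λ m → applyCollision m (π , P)) hit

  private
    S₁ = Fin r →-setoid Fin r
    S₂ = Fin r →-setoid Path N

  Bad-resp : ∀ {z z′} → z ≃ z′ → Bad z → Bad z′
  Bad-resp {π , P} {π′ , P′} (π≗π′ , P≗P′) (ends , intersecting) =
    (λ i → ≡.trans (≡.cong (endRes (a i)) (≡.sym (P≗P′ i))) (≡.trans (ends i) (≡.cong e (π≗π′ i)))) ,
    λ disjoint → intersecting λ k l k≢l t → ≡.subst₂ (λ p q → ¬ res (Vec.lookup (trace (+ a k) p) t) ≡ res (Vec.lookup (trace (+ a l) q) t))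
                                                    (≡.sym (P≗P′ k)) (≡.sym (P≗P′ l)) (disjoint k l k≢l t)

  signedWeight-cong : ∀ {z z′} → z ≃ z′ → signedWeight z ≈ signedWeight z′
  signedWeight-cong (π≗π′ , P≗P′) = *-cong (sgn-cong π≗π′) (prodFin-cong r λ k → reflexive (≡.cong (weight M (a k)) (P≗P′ k)))

  involution-cong : ∀ {z z′} → z ≃ z′ → involution z ≃ involution z′
  involution-cong {π , P} {π′ , P′} z≃z′@(π≗π′ , P≗P′) =
    ≡.subst (λ m → applyCollision m (π , P) ≃ involution (π′ , P′)) (≡.sym (firstCollision-cong (residues-cong P≗P′)))
            (apply-cong (firstCollision (residues P′)))
    where
    apply-cong : ∀ m → applyCollision m (π , P) ≃ applyCollision m (π′ , P′)
    apply-cong (just (t , k , l)) = (λ i → π≗π′ (transpose k l i)) , λ i → ≡.cong₂ (swapAt t) (P≗P′ i) (P≗P′ (transpose k l i))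
    apply-cong nothing            = z≃z′

  badConfig-member : ∀ {z} → z ∈ᶜ badConfigs → IsPerm (proj₁ z) × Bad z
  badConfig-member z∈ with MemSₚ.∈-filter⁻ Configs bad? Bad-resp {xs = cartesianProduct (perms r) families} z∈
  ... | z∈pairs , bad = proj₂ (MemSₚ.∈-filter⁻ S₁ isPerm? IsPerm-resp {xs = allFun r (allFin r)}
                               (proj₁ (MemSₚ.∈-cartesianProduct⁻ S₁ S₂ (perms r) families z∈pairs))) , bad

  badConfig-collision : ∀ {z} → z ∈ᶜ badConfigs → ∃ λ (h : Hit N) → firstCollision (residues (proj₂ z)) ≡ just h
  badConfig-collision {z} z∈ = collision {proj₂ z} (proj₂ (proj₂ (badConfig-member z∈)))

  involution-bad : ∀ {z} → z ∈ᶜ badConfigs → involution z ∈ᶜ badConfigs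
  involution-bad {π , P} z∈ with badConfig-member z∈ | badConfig-collision z∈
  ... | π-perm , ends , _ | (t , k , l) , hit = ≡.subst (_∈ᶜ badConfigs) (≡.sym (involution-hit {P} hit))
    (MemSₚ.∈-filter⁺ Configs bad? Bad-resp
      (MemSₚ.∈-cartesianProduct⁺ S₁ S₂ (perms-complete (IsPerm-∘ π-perm (involution⇒IsPerm (transpose-involutive k l))))
                                      (allFun-complete r (swapFamily t k l P) λ i → allPaths-complete _))
      (swapFamily-endsAt {P} hit ends ,
       λ disjoint → disjoint k l (k≢l {P} hit) t (proj₂ (firstCollision-sound _ (swapFamily-hit {P} hit)))))

  involution-involutive : ∀ {z} → z ∈ᶜ badConfigs → involution (involution z) ≃ z
  involution-involutive {π , P} z∈ with badConfig-collision z∈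
  ... | (t , k , l) , hit =
    ≃-trans (≃-reflexive (≡.trans (≡.cong involution (involution-hit {P} hit)) (involution-hit (swapFamily-hit {P} hit))))
            ((λ i → ≡.cong π (transpose-involutive k l i)) , swapFamily-involutive {P} hit)

  involution-unfixed : ∀ {z} → z ∈ᶜ badConfigs → ¬ involution z ≃ z
  involution-unfixed {π , P} z∈ fixes with badConfig-member z∈ | badConfig-collision z∈
  ... | π-perm , _ | (t , k , l) , hit =
    k≢l {P} hit (≡.sym (π-perm l k (≡.trans (≡.cong π (≡.sym (transpose-matchˡ k l))) (proj₁ swapped-fixed k))))
    where swapped-fixed = ≃-trans (≃-reflexive (≡.sym (involution-hit {P} hit))) fixes

  signedWeight-involution : ∀ {z} → z ∈ᶜ badConfigs → signedWeight z + signedWeight (involution z) ≈ 0#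
  signedWeight-involution {π , P} z∈ with badConfig-member z∈ | badConfig-collision z∈
  ... | π-perm , _ | (t , k , l) , hit = begin
    signedWeight (π , P) + signedWeight (involution (π , P))
      ≡⟨ ≡.cong (λ z → signedWeight (π , P) + signedWeight z) (involution-hit {P} hit) ⟩
    sgn π * familyWeight P + sgn (π ∘ transpose k l) * familyWeight (swapFamily t k l P)
      ≈⟨ +-congˡ (*-cong (sgn-∘-transpose π-perm (k≢l {P} hit)) (familyWeight-swapFamily {P} hit)) ⟩
    sgn π * familyWeight P + - sgn π * familyWeight P   ≈⟨ +-congˡ (-‿distribˡ-* _ _) ⟨
    sgn π * familyWeight P + - (sgn π * familyWeight P) ≈⟨ -‿inverseʳ _ ⟩
    0#                                                 ∎
    where open import Relation.Binary.Reasoning.Setoid setoid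

  badConfigs-cancel : Σ.foldMap signedWeight badConfigs ≈ 0#
  badConfigs-cancel = trans
    (Σ.foldMap-involution Configs (λ _ → refl) signedWeight-cong involution involution-cong badConfigs
      (UniqueSₚ.filter⁺ Configs bad? (UniqueSₚ.cartesianProduct⁺ S₁ S₂ perms-unique (allFun-unique r (allPaths-unique N))))
      involution-bad involution-involutive (λ z∈ fixes → contradiction fixes (involution-unfixed z∈))
      (λ z∈ → trans (signedWeight-involution z∈) (sym (+-identityʳ 0#))))
    (Σ.foldMap-ε (All.universal (λ _ → refl) badConfigs))

  open PathGeneratingFunction R x y yinv M using (weightEndingAt; q≈foldMap-weightEndingAt)
  open Products R x y yinv using (prodFin-foldMap; prodFin-if; *-distribˡ-foldMap)

  private
    *-if : ∀ b z u → z * (if b then u else 0#) ≈ (if b then z * u else 0#)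
    *-if true  z u = refl
    *-if false z u = zeroʳ z

    if-split : ∀ b c u → (if b then u else 0#) ≈ (if b ∧ c then u else 0#) + (if b ∧ not c then u else 0#)
    if-split false c     u = sym (+-identityˡ 0#)
    if-split true  true  u = sym (+-identityʳ u)
    if-split true  false u = sym (+-identityˡ u)

  signedWeightWhere : (Config → Bool) → Config → Carrier
  signedWeightWhere b z = if b z then signedWeight z else 0#

  sumWhere : (Config → Bool) → Carrier
  sumWhere b = Σ.foldMap (λ π → Σ.foldMap (λ P → signedWeightWhere b (π , P)) families) (perms r)

  sumWhere-split : ∀ (b c : Config → Bool) → sumWhere b ≈ sumWhere (λ z → b z ∧ c z) + sumWhere (λ z → b z ∧ not (c z))
  sumWhere-split b c = trans
    (Σ.foldMap-cong (λ π → trans (Σ.foldMap-cong (λ P → if-split (b (π , P)) (c (π , P)) (signedWeight (π , P))) families)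
                                 (Σ.foldMap-∙ (λ P → signedWeightWhere b∧c (π , P)) (λ P → signedWeightWhere b∧¬c (π , P)) families))
                    (perms r))
    (Σ.foldMap-∙ (λ π → Σ.foldMap (λ P → signedWeightWhere b∧c (π , P)) families)
                 (λ π → Σ.foldMap (λ P → signedWeightWhere b∧¬c (π , P)) families) (perms r))
    where
    b∧c b∧¬c : Config → Bool
    b∧c z = b z ∧ c z
    b∧¬c z = b z ∧ not (c z)

  lhs≈sumWhere : lhs M N r a e ≈ sumWhere (λ z → does (endsAt? a e (proj₁ z) (proj₂ z)) ∧ does (nonIntersecting? a (proj₂ z)))
  lhs≈sumWhere = Σ.foldMap-cong (λ π → Σ.foldMap-filter (admissible? a e π) (λ P → signedWeight (π , P)) families) (perms r)

  badConfigs≈sumWhere : Σ.foldMap signedWeight badConfigs ≈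
    sumWhere (λ z → does (endsAt? a e (proj₁ z) (proj₂ z)) ∧ not (does (nonIntersecting? a (proj₂ z))))
  badConfigs≈sumWhere = trans (Σ.foldMap-filter bad? signedWeight (cartesianProduct (perms r) families))
                              (Σ.foldMap-cartesianProductWith (λ z → if does (bad? z) then signedWeight z else 0#) _,_ (perms r) families)

  det≈sumWhere : (∀ i → e i ℕ.< M) → det r (λ i j → q M N (+ a i) (+ e j)) ≈ sumWhere (λ z → does (endsAt? a e (proj₁ z) (proj₂ z)))
  det≈sumWhere e<M = Σ.foldMap-cong expand (perms r)
    where
    open import Relation.Binary.Reasoning.Setoid setoid
    expand : ∀ π → sgn π * prodFin r (λ i → q M N (+ a i) (+ e (π i))) ≈
                   Σ.foldMap (λ P → if does (endsAt? a e π P) then signedWeight (π , P) else 0#) families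
    expand π = begin
      sgn π * prodFin r (λ i → q M N (+ a i) (+ e (π i)))
        ≈⟨ *-congˡ (prodFin-cong r λ i → q≈foldMap-weightEndingAt N (a i) (e (π i)) (e<M (π i))) ⟩
      sgn π * prodFin r (λ i → Σ.foldMap (weightEndingAt (a i) (e (π i))) (allPaths N))
        ≈⟨ *-congˡ (prodFin-foldMap r (λ i → weightEndingAt (a i) (e (π i))) (allPaths N)) ⟩
      sgn π * Σ.foldMap (λ P → prodFin r (λ i → weightEndingAt (a i) (e (π i)) (P i))) families
        ≈⟨ *-congˡ (Σ.foldMap-cong (λ P → prodFin-if r (λ i → endRes (a i) (P i) ℕ.≟ e (π i)) (λ i → weight M (a i) (P i))) families) ⟩
      sgn π * Σ.foldMap (λ P → if does (endsAt? a e π P) then familyWeight P else 0#) families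
        ≈⟨ *-distribˡ-foldMap (sgn π) _ families ⟩
      Σ.foldMap (λ P → sgn π * (if does (endsAt? a e π P) then familyWeight P else 0#)) families
        ≈⟨ Σ.foldMap-cong (λ P → *-if (does (endsAt? a e π P)) (sgn π) (familyWeight P)) families ⟩
      Σ.foldMap (λ P → if does (endsAt? a e π P) then signedWeight (π , P) else 0#) families ∎

  lhs≈det : (∀ i → e i ℕ.< M) → lhs M N r a e ≈ det r (λ i j → q M N (+ a i) (+ e j))
  lhs≈det e<M = begin
    lhs M N r a e                         ≈⟨ lhs≈sumWhere ⟩
    sumWhere nonIntersecting              ≈⟨ +-identityʳ _ ⟨
    sumWhere nonIntersecting + 0#         ≈⟨ +-congˡ (trans (sym badConfigs≈sumWhere) badConfigs-cancel) ⟨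
    sumWhere nonIntersecting + sumWhere intersecting ≈⟨ sumWhere-split endsAt (does ∘ nonIntersecting? a ∘ proj₂) ⟨
    sumWhere endsAt                       ≈⟨ det≈sumWhere e<M ⟨
    det r (λ i j → q M N (+ a i) (+ e j)) ∎
    where
    open import Relation.Binary.Reasoning.Setoid setoid
    endsAt nonIntersecting intersecting : Config → Bool
    endsAt z = does (endsAt? a e (proj₁ z) (proj₂ z))
    nonIntersecting z = endsAt z ∧ does (nonIntersecting? a (proj₂ z))
    intersecting z = endsAt z ∧ not (does (nonIntersecting? a (proj₂ z)))

mainTheorem2 : ∀ {c ℓ : Level} (R : CommutativeRing c ℓ)
    (x y yinv : CommutativeRing.Carrier R) →
    CommutativeRing._≈_ R (CommutativeRing._*_ R y yinv) (CommutativeRing.1# R) →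
    (M N r : ℕ) .{{_ : NonZero M}} → 1 ≤ r →
    (a e : Fin r → ℕ) →
    (∀ (i j : Fin r) → i Fin.< j → a i ℕ.< a j) → (∀ (i : Fin r) → a i ℕ.< M) →
    (∀ (i j : Fin r) → i Fin.< j → e i ℕ.< e j) → (∀ (i : Fin r) → e i ℕ.< M) →
    (∀ (i j : Fin r) → (+ 2) ∣ ((+ N) ℤ.- (+ e i) ℤ.+ (+ a j))) →
    CommutativeRing._≈_ R
      (RingDefs.lhs R x y yinv M N r a e)
      (RingDefs.det R x y yinv r (λ i j → RingDefs.q R x y yinv M N (+ a i) (+ e j)))
mainTheorem2 R x y yinv y*yinv≈1 M N r _ a e _ _ _ e<M _ = LGV.lhs≈det R x y yinv y*yinv≈1 M N r a e e<M
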